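{- Let $p$ be an odd prime and $x$ a rational number with denominator not divisible by $p$, such that $x\not\equiv0,1\pmod p$. (i) If $p\equiv1\pmod 4$, then $$\sum_{k=0}^{[p/4]}\binom{4k}{2k}\Big(\frac x{16}\Big)^k\equiv x^{\frac{p-1}4}\sum_{k=0}^{[p/4]}\binom{4k}{2k}\frac1{(16x)^k}\pmod p.$$ (ii) If $p\equiv3\pmod 4$, then $$\sum_{k=0}^{[p/4]}\binom{4k}{2k}\frac1{(16x)^k}\equiv\Big(1-\frac1x\Big)^{\frac{p-3}4}\sum_{k=0}^{[p/4]}\binom{4k}{2k}\frac1{(16(1-x))^k}\pmod p.$$
   Context: $[x]$ is the greatest integer not exceeding $x$. Congruences mod $p$ are taken in the ring of rationals with denominator prime to $p$. -}

module Defs where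

open import Data.Nat as ℕ using (ℕ; zero; suc)
open import Data.Nat.Combinatorics using (_C_)
open import Data.Nat.Divisibility as ℕD using ()
open import Data.Integer as ℤ using (ℤ; +_)
open import Data.Rational as ℚ using (ℚ; ↥_; ↧ₙ_; 0ℚ; 1ℚ; _+_; _*_; _-_)
open import Data.Rational.Properties using (_≟_)
open import Data.Product using (Σ; _×_; _,_)
open import Relation.Binary.PropositionalEquality using (_≡_)
open import Relation.Nullary using (¬_; yes; no)

_^ℚ_ : ℚ → ℕ → ℚ
x ^ℚ zero = 1ℚ
x ^ℚ suc n = x * (x ^ℚ n)

-- total inverse (inv 0 = 0); only ever applied to nonzero arguments
inv : ℚ → ℚ
inv x with x ≟ 0ℚ
... | yes _ = 0ℚ
... | no x≢0 = ℚ.1/_ x {{ℚ.≢-nonZero x≢0}}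

nℚ : ℕ → ℚ
nℚ n = (+ n) ℚ./ 1

PIntegral : ℕ → ℚ → Set
PIntegral p x = ¬ (p ℕD.∣ ↧ₙ x)

-- congruence modulo p in the ring Z_(p) of rationals with denominator prime to p:
-- a ≡ b (mod p) iff a, b ∈ Z_(p) and a - b = p · c for some c ∈ Z_(p)
CongQ : ℚ → ℚ → ℕ → Set
CongQ a b p = PIntegral p a × PIntegral p b
            × Σ ℚ (λ c → PIntegral p c × (a - b ≡ nℚ p * c))

sumTo : ℕ → (ℕ → ℚ) → ℚ
sumTo zero f = f zero
sumTo (suc n) f = sumTo n f + f (suc n)

binomℚ : ℕ → ℕ → ℚ
binomℚ n k = nℚ (n C k)

module Submission where

-- Write A k = C(4k,2k)/16ᵏ and S_q(z) = Σ_{k≤q} A k zᵏ with q = ⌊p/4⌋; both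
-- parts compare values of S_q.  The key exact identity is A k = C(-1/2, 2k),
-- C(β, j) = β(β-1)…(β-j+1)/j! being the generalised binomial coefficient.
-- (i)  p = 4q+1: -1/2 ≡ 2q (mod p), so A k ≡ C(2q, 2k) and S_q(x) is congruent
--      to the palindromic Σ C(2q,2k) xᵏ = x^q Σ C(2q,2k) x⁻ᵏ ≡ x^q S_q(1/x).
-- (ii) p = 4q+3: -3/4 ≡ q (mod p).  With y = 1/x, (1-y)^q S_q(1/(1-x)) equals
--      Σ_k A k (-y)ᵏ (1-y)^{q-k}; expanding binomially and replacing C(q-k, j)
--      by C(-3/4-k, j), the coefficient of (-y)ⁿ is Σ_k A k C(-3/4-k, n-k),
--      which is (-1)ⁿ A n by Chu–Vandermonde, using the hypergeometric form
--      A k = (-1)ᵏ C(-3/4, k) (1/4)ₖ/(1/2)ₖ.  So the sum is S_q(y).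

open import Defs
open import Data.Nat as ℕ using (ℕ; zero; suc; _∸_; _!)
import Data.Nat.Properties as ℕP
open import Data.Nat.DivMod using (_/_; _%_; m≡m%n+[m/n]*n; m*n/n≡m; m/n*n≡m)
open import Data.Nat.Divisibility using (_∣_; divides; ∣-trans; ∣⇒≤)
open import Data.Nat.Coprimality using (coprime?; coprime-divisor)
import Data.Nat.Coprimality as Coprimality
open import Data.Nat.Primality using (Prime; euclidsLemma; prime⇒nonTrivial)
open import Data.Nat.Combinatorics
  using (_C_; nCk+nC[k+1]≡[n+1]C[k+1]; k>n⇒nCk≡0; nC1≡n; nCk≡nC[n∸k]; nCk≡n!/k![n-k]!; k![n∸k]!∣n!)
open import Data.Integer as ℤ using (ℤ; +_)
import Data.Integer.Properties as ℤP
import Data.Integer.Divisibility.Signed as ℤSigned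
open import Data.Rational as ℚ using (ℚ; mkℚ; 0ℚ; 1ℚ; _+_; _*_; _-_; -_; toℚᵘ)
import Data.Rational.Properties as ℚP
import Data.Rational.Unnormalised as ℚᵘ
import Data.Rational.Unnormalised.Properties as ℚᵘP
open import Data.Rational.Solver using (module +-*-Solver)
open +-*-Solver
open import Data.Product using (_×_; _,_)
open import Data.Sum using (inj₁; inj₂)
open import Data.Empty using (⊥-elim)
open import Function using (_∘_)
open import Relation.Binary.PropositionalEquality
open import Relation.Nullary using (¬_; yes; no; Dec)
open import Relation.Nullary.Decidable using (recompute)

zℚ : ℤ → ℚ
zℚ a = a ℚ./ 1

toℚᵘ-zℚ : ∀ a → toℚᵘ (zℚ a) ℚᵘ.≃ ℚᵘ.mkℚᵘ a 0
toℚᵘ-zℚ a = ℚP.toℚᵘ-fromℚᵘ (ℚᵘ.mkℚᵘ a 0)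

zℚ-+ : ∀ a b → zℚ (a ℤ.+ b) ≡ zℚ a + zℚ b
zℚ-+ a b = ℚP.toℚᵘ-injective (ℚᵘP.≃-trans (toℚᵘ-zℚ (a ℤ.+ b))
  (ℚᵘP.≃-trans (ℚᵘ.*≡* cross) (ℚᵘP.≃-sym (ℚᵘP.≃-trans (ℚP.toℚᵘ-homo-+ (zℚ a) (zℚ b)) (ℚᵘP.+-cong (toℚᵘ-zℚ a) (toℚᵘ-zℚ b))))))
  where
  cross : (a ℤ.+ b) ℤ.* + 1 ≡ (a ℤ.* + 1 ℤ.+ b ℤ.* + 1) ℤ.* + 1
  cross = cong (ℤ._* + 1) (cong₂ ℤ._+_ (sym (ℤP.*-identityʳ a)) (sym (ℤP.*-identityʳ b)))

zℚ-* : ∀ a b → zℚ (a ℤ.* b) ≡ zℚ a * zℚ b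
zℚ-* a b = ℚP.toℚᵘ-injective (ℚᵘP.≃-trans (toℚᵘ-zℚ (a ℤ.* b))
  (ℚᵘP.≃-trans (ℚᵘ.*≡* refl) (ℚᵘP.≃-sym (ℚᵘP.≃-trans (ℚP.toℚᵘ-homo-* (zℚ a) (zℚ b)) (ℚᵘP.*-cong (toℚᵘ-zℚ a) (toℚᵘ-zℚ b))))))

zℚ-neg : ∀ a → zℚ (ℤ.- a) ≡ - zℚ a
zℚ-neg a = ℚP.toℚᵘ-injective (ℚᵘP.≃-trans (toℚᵘ-zℚ (ℤ.- a))
  (ℚᵘP.≃-trans (ℚᵘ.*≡* refl) (ℚᵘP.≃-sym (ℚᵘP.≃-trans (ℚP.toℚᵘ-homo‿- (zℚ a)) (ℚᵘP.-‿cong (toℚᵘ-zℚ a))))))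

zℚ≡0 : ∀ {a} → zℚ a ≡ 0ℚ → a ≡ + 0
zℚ≡0 {a} e with ℚᵘP.≃-trans (ℚᵘP.≃-sym (toℚᵘ-zℚ a)) (ℚP.toℚᵘ-cong e)
... | ℚᵘ.*≡* a*1≡0 = trans (sym (ℤP.*-identityʳ a)) a*1≡0

nℚ-+ : ∀ m n → nℚ (m ℕ.+ n) ≡ nℚ m + nℚ n
nℚ-+ m n = zℚ-+ (+ m) (+ n)

nℚ-* : ∀ m n → nℚ (m ℕ.* n) ≡ nℚ m * nℚ n
nℚ-* m n = trans (cong zℚ (ℤP.pos-* m n)) (zℚ-* (+ m) (+ n))

nℚ-suc : ∀ n → nℚ (suc n) ≡ 1ℚ + nℚ n
nℚ-suc n = nℚ-+ 1 n

nℚ-double : ∀ j → nℚ (2 ℕ.* j) ≡ nℚ j + nℚ j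
nℚ-double j = trans (cong (λ m → nℚ (j ℕ.+ m)) (ℕP.+-identityʳ j)) (nℚ-+ j j)

nℚ-∸ : ∀ {q k} → k ℕ.≤ q → nℚ (q ∸ k) ≡ nℚ q - nℚ k
nℚ-∸ {q} {k} k≤q = begin
  nℚ (q ∸ k)                  ≡⟨ solve 2 (λ a K → a := (a :+ K) :- K) refl (nℚ (q ∸ k)) (nℚ k) ⟩
  (nℚ (q ∸ k) + nℚ k) - nℚ k  ≡⟨ cong (_- nℚ k) (trans (sym (nℚ-+ (q ∸ k) k)) (cong nℚ (ℕP.m∸n+n≡m k≤q))) ⟩
  nℚ q - nℚ k                 ∎
  where open ≡-Reasoning

nℚ≢0 : ∀ {n} → n ≢ 0 → nℚ n ≢ 0ℚ
nℚ≢0 n≢0 e = n≢0 (ℤP.+-injective (zℚ≡0 e))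

nℚ-suc≢0 : ∀ n → nℚ (suc n) ≢ 0ℚ
nℚ-suc≢0 n = nℚ≢0 {suc n} (λ ())

inv-inverseˡ : ∀ {x} → x ≢ 0ℚ → inv x * x ≡ 1ℚ
inv-inverseˡ {x} x≢0 with x ℚP.≟ 0ℚ
... | yes x≡0 = ⊥-elim (x≢0 x≡0)
... | no x≢0′ = ℚP.*-inverseˡ x {{ℚ.≢-nonZero x≢0′}}

inv-inverseʳ : ∀ {x} → x ≢ 0ℚ → x * inv x ≡ 1ℚ
inv-inverseʳ {x} x≢0 = trans (ℚP.*-comm x (inv x)) (inv-inverseˡ x≢0)

*-≢0 : ∀ {a b} → a ≢ 0ℚ → b ≢ 0ℚ → a * b ≢ 0ℚ
*-≢0 {a} {b} a≢0 b≢0 ab≡0 = b≢0 (begin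
  b                ≡⟨ sym (ℚP.*-identityˡ b) ⟩
  1ℚ * b           ≡⟨ cong (_* b) (sym (inv-inverseˡ a≢0)) ⟩
  (inv a * a) * b  ≡⟨ ℚP.*-assoc (inv a) a b ⟩
  inv a * (a * b)  ≡⟨ cong (inv a *_) ab≡0 ⟩
  inv a * 0ℚ       ≡⟨ ℚP.*-zeroʳ (inv a) ⟩
  0ℚ               ∎)
  where open ≡-Reasoning

inv-unique : ∀ {a b} → a * b ≡ 1ℚ → inv a ≡ b
inv-unique {a} {b} ab≡1 = begin
  inv a            ≡⟨ sym (ℚP.*-identityʳ (inv a)) ⟩
  inv a * 1ℚ       ≡⟨ cong (inv a *_) (sym ab≡1) ⟩
  inv a * (a * b)  ≡⟨ sym (ℚP.*-assoc (inv a) a b) ⟩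
  (inv a * a) * b  ≡⟨ cong (_* b) (inv-inverseˡ a≢0) ⟩
  1ℚ * b           ≡⟨ ℚP.*-identityˡ b ⟩
  b                ∎
  where
  open ≡-Reasoning
  a≢0 : a ≢ 0ℚ
  a≢0 a≡0 with trans (sym (trans (cong (_* b) a≡0) (ℚP.*-zeroˡ b))) ab≡1
  ... | ()

-- `inv` is multiplicative (also when a factor is 0, as inv 0 = 0).
inv-* : ∀ a b → inv (a * b) ≡ inv a * inv b
inv-* a b = by-cases (a ℚP.≟ 0ℚ) (b ℚP.≟ 0ℚ)
  where
  open ≡-Reasoning
  by-cases : Dec (a ≡ 0ℚ) → Dec (b ≡ 0ℚ) → inv (a * b) ≡ inv a * inv b
  by-cases (yes refl) _ = begin
    inv (0ℚ * b)     ≡⟨ cong inv (ℚP.*-zeroˡ b) ⟩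
    0ℚ               ≡⟨ sym (ℚP.*-zeroˡ (inv b)) ⟩
    inv 0ℚ * inv b   ∎
  by-cases (no _) (yes refl) = begin
    inv (a * 0ℚ)     ≡⟨ cong inv (ℚP.*-zeroʳ a) ⟩
    0ℚ               ≡⟨ sym (ℚP.*-zeroʳ (inv a)) ⟩
    inv a * inv 0ℚ   ∎
  by-cases (no a≢0) (no b≢0) = inv-unique {a * b} (begin
    a * b * (inv a * inv b)    ≡⟨ solve 4 (λ a b c d → a :* b :* (c :* d) := (a :* c) :* (b :* d)) refl a b (inv a) (inv b) ⟩
    (a * inv a) * (b * inv b)  ≡⟨ cong₂ _*_ (inv-inverseʳ a≢0) (inv-inverseʳ b≢0) ⟩
    1ℚ                         ∎)

*-cancelʳ : ∀ {x y f} → f ≢ 0ℚ → x * f ≡ y * f → x ≡ y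
*-cancelʳ {x} {y} {f} f≢0 e = begin
  x                  ≡⟨ sym (ℚP.*-identityʳ x) ⟩
  x * 1ℚ             ≡⟨ cong (x *_) (sym (inv-inverseʳ f≢0)) ⟩
  x * (f * inv f)    ≡⟨ sym (ℚP.*-assoc x f (inv f)) ⟩
  (x * f) * inv f    ≡⟨ cong (_* inv f) e ⟩
  (y * f) * inv f    ≡⟨ ℚP.*-assoc y f (inv f) ⟩
  y * (f * inv f)    ≡⟨ cong (y *_) (inv-inverseʳ f≢0) ⟩
  y * 1ℚ             ≡⟨ ℚP.*-identityʳ y ⟩
  y                  ∎
  where open ≡-Reasoning

solve-for : ∀ {x B A} → B ≢ 0ℚ → x * B ≡ A → x ≡ A * inv B
solve-for {x} {B} {A} B≢0 e = begin
  x                ≡⟨ sym (ℚP.*-identityʳ x) ⟩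
  x * 1ℚ           ≡⟨ cong (x *_) (sym (inv-inverseʳ B≢0)) ⟩
  x * (B * inv B)  ≡⟨ sym (ℚP.*-assoc x B (inv B)) ⟩
  x * B * inv B    ≡⟨ cong (_* inv B) e ⟩
  A * inv B        ∎
  where open ≡-Reasoning

solve-for-inv : ∀ {x B A} → A ≢ 0ℚ → x * B ≡ A → inv x * A ≡ B
solve-for-inv {x} {B} {A} A≢0 e = begin
  inv x * A          ≡⟨ cong (_* A) (inv-unique {x} x*[B/A]≡1) ⟩
  B * inv A * A      ≡⟨ ℚP.*-assoc B (inv A) A ⟩
  B * (inv A * A)    ≡⟨ cong (B *_) (inv-inverseˡ A≢0) ⟩
  B * 1ℚ             ≡⟨ ℚP.*-identityʳ B ⟩
  B                  ∎
  where
  open ≡-Reasoning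
  x*[B/A]≡1 : x * (B * inv A) ≡ 1ℚ
  x*[B/A]≡1 = trans (sym (ℚP.*-assoc x B (inv A))) (trans (cong (_* inv A) e) (inv-inverseʳ A≢0))

inverse-of-one : ∀ {x y} → x * y ≡ 1ℚ → 1ℚ - y ≡ 0ℚ → x ≡ 1ℚ
inverse-of-one {x} {y} xy≡1 1-y≡0 = begin
  x       ≡⟨ sym (ℚP.*-identityʳ x) ⟩
  x * 1ℚ  ≡⟨ cong (x *_) (sym y≡1) ⟩
  x * y   ≡⟨ xy≡1 ⟩
  1ℚ      ∎
  where
  open ≡-Reasoning
  y≡1 : y ≡ 1ℚ
  y≡1 = trans (solve 1 (λ y → y := con 1ℚ :- (con 1ℚ :- y)) refl y) (cong (_-_ 1ℚ) 1-y≡0)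

^ℚ-distrib-* : ∀ a b k → (a * b) ^ℚ k ≡ (a ^ℚ k) * (b ^ℚ k)
^ℚ-distrib-* a b zero = refl
^ℚ-distrib-* a b (suc k) = trans (cong ((a * b) *_) (^ℚ-distrib-* a b k))
  (solve 4 (λ a b c d → a :* b :* (c :* d) := (a :* c) :* (b :* d)) refl a b (a ^ℚ k) (b ^ℚ k))

^ℚ-+ : ∀ a m n → a ^ℚ (m ℕ.+ n) ≡ (a ^ℚ m) * (a ^ℚ n)
^ℚ-+ a zero n = sym (ℚP.*-identityˡ _)
^ℚ-+ a (suc m) n = trans (cong (a *_) (^ℚ-+ a m n)) (sym (ℚP.*-assoc a _ _))

1^ℚ : ∀ k → 1ℚ ^ℚ k ≡ 1ℚ
1^ℚ zero = refl
1^ℚ (suc k) = trans (ℚP.*-identityˡ _) (1^ℚ k)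

inv-^ℚ : ∀ a k → inv (a ^ℚ k) ≡ (inv a) ^ℚ k
inv-^ℚ a zero = refl
inv-^ℚ a (suc k) = trans (inv-* a (a ^ℚ k)) (cong (inv a *_) (inv-^ℚ a k))

^ℚ-double : ∀ a k → a ^ℚ (2 ℕ.* k) ≡ (a * a) ^ℚ k
^ℚ-double a zero = refl
^ℚ-double a (suc k) = begin
  a ^ℚ (2 ℕ.* suc k)           ≡⟨ cong (a ^ℚ_) (ℕP.*-suc 2 k) ⟩
  a * (a * (a ^ℚ (2 ℕ.* k)))   ≡⟨ sym (ℚP.*-assoc a a _) ⟩
  (a * a) * (a ^ℚ (2 ℕ.* k))   ≡⟨ cong ((a * a) *_) (^ℚ-double a k) ⟩
  (a * a) ^ℚ suc k             ∎
  where open ≡-Reasoning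

^ℚ-split : ∀ a {q k} → k ℕ.≤ q → a ^ℚ q ≡ (a ^ℚ (q ∸ k)) * (a ^ℚ k)
^ℚ-split a {q} {k} k≤q = trans (cong (a ^ℚ_) (sym (ℕP.m∸n+n≡m k≤q))) (^ℚ-+ a (q ∸ k) k)

^ℚ-inverse : ∀ {a b} k → a * b ≡ 1ℚ → (a ^ℚ k) * (b ^ℚ k) ≡ 1ℚ
^ℚ-inverse {a} {b} k ab≡1 = trans (sym (^ℚ-distrib-* a b k)) (trans (cong (_^ℚ k) ab≡1) (1^ℚ k))

sgn : ℕ → ℚ
sgn k = (- 1ℚ) ^ℚ k

sgn-square : ∀ n → sgn n * sgn n ≡ 1ℚ
sgn-square n = ^ℚ-inverse n refl

neg-^ℚ : ∀ y n → (- y) ^ℚ n ≡ sgn n * (y ^ℚ n)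
neg-^ℚ y n = trans (cong (_^ℚ n) (solve 1 (λ y → :- y := con (- 1ℚ) :* y) refl y)) (^ℚ-distrib-* (- 1ℚ) y n)

sum-cong : ∀ n {f g : ℕ → ℚ} → (∀ k → k ℕ.≤ n → f k ≡ g k) → sumTo n f ≡ sumTo n g
sum-cong zero f≡g = f≡g 0 ℕ.z≤n
sum-cong (suc n) f≡g = cong₂ _+_ (sum-cong n (λ k k≤n → f≡g k (ℕP.m≤n⇒m≤1+n k≤n))) (f≡g (suc n) ℕP.≤-refl)

sum-+ : ∀ n (f g : ℕ → ℚ) → sumTo n (λ k → f k + g k) ≡ sumTo n f + sumTo n g
sum-+ zero f g = refl
sum-+ (suc n) f g = trans (cong (_+ (f (suc n) + g (suc n))) (sum-+ n f g))
  (solve 4 (λ a b c d → (a :+ b) :+ (c :+ d) := (a :+ c) :+ (b :+ d)) refl (sumTo n f) (sumTo n g) (f (suc n)) (g (suc n)))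

sum-scale : ∀ n a (f : ℕ → ℚ) → sumTo n (λ k → a * f k) ≡ a * sumTo n f
sum-scale zero a f = refl
sum-scale (suc n) a f = trans (cong (_+ (a * f (suc n))) (sum-scale n a f)) (sym (ℚP.*-distribˡ-+ a (sumTo n f) (f (suc n))))

sum-shift : ∀ n (f : ℕ → ℚ) → sumTo (suc n) f ≡ f 0 + sumTo n (λ k → f (suc k))
sum-shift zero f = refl
sum-shift (suc n) f = trans (cong (_+ f (suc (suc n))) (sum-shift n f)) (ℚP.+-assoc (f 0) _ _)

sum-reverse : ∀ n (f : ℕ → ℚ) → sumTo n f ≡ sumTo n (λ k → f (n ∸ k))
sum-reverse zero f = refl
sum-reverse (suc n) f = sym (begin
  sumTo (suc n) (λ k → f (suc n ∸ k))   ≡⟨ sum-shift n (λ k → f (suc n ∸ k)) ⟩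
  f (suc n) + sumTo n (λ k → f (n ∸ k))  ≡⟨ cong (_+_ (f (suc n))) (sym (sum-reverse n f)) ⟩
  f (suc n) + sumTo n f                  ≡⟨ ℚP.+-comm (f (suc n)) (sumTo n f) ⟩
  sumTo n f + f (suc n)                  ∎)
  where open ≡-Reasoning

-- In the
-- step q → q+1, the new diagonal n = q+1 collects the last term of each inner
-- sum (k ≤ q) together with the new corner term f (q+1) 0.
sum-triangle : ∀ q (f : ℕ → ℕ → ℚ) →
  sumTo q (λ k → sumTo (q ∸ k) (f k)) ≡ sumTo q (λ n → sumTo n (λ k → f k (n ∸ k)))
sum-triangle zero f = refl
sum-triangle (suc q) f = begin
  sumTo q (λ k → sumTo (suc q ∸ k) (f k)) + sumTo (q ∸ q) (f (suc q))
    ≡⟨ cong₂ _+_ (sum-cong q (λ k k≤q → cong (λ m → sumTo m (f k)) (ℕP.+-∸-assoc 1 k≤q)))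
                 (cong (λ m → sumTo m (f (suc q))) (ℕP.n∸n≡0 q)) ⟩
  sumTo q (λ k → sumTo (q ∸ k) (f k) + f k (suc (q ∸ k))) + f (suc q) 0
    ≡⟨ cong (_+ f (suc q) 0) (sum-+ q _ _) ⟩
  (Old + New) + f (suc q) 0
    ≡⟨ ℚP.+-assoc Old New (f (suc q) 0) ⟩
  Old + (New + f (suc q) 0)
    ≡⟨ cong₂ _+_ (sum-triangle q f)
         (cong₂ _+_ (sum-cong q (λ k k≤q → cong (f k) (sym (ℕP.+-∸-assoc 1 k≤q))))
                    (cong (f (suc q)) (sym (ℕP.n∸n≡0 q)))) ⟩
  sumTo q (λ n → sumTo n (λ k → f k (n ∸ k))) + (sumTo q (λ k → f k (suc q ∸ k)) + f (suc q) (q ∸ q)) ∎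
  where
  open ≡-Reasoning
  Old New : ℚ
  Old = sumTo q (λ k → sumTo (q ∸ k) (f k))
  New = sumTo q (λ k → f k (suc (q ∸ k)))

pascal-sum : ∀ n (t : ℕ → ℚ) →
  sumTo (suc n) (λ k → binomℚ (suc n) k * t k)
    ≡ sumTo n (λ k → binomℚ n k * t k) + sumTo n (λ k → binomℚ n k * t (suc k))
pascal-sum n t = begin
  sumTo (suc n) (λ k → binomℚ (suc n) k * t k)
    ≡⟨ sum-shift n _ ⟩
  binomℚ (suc n) 0 * t 0 + sumTo n (λ k → binomℚ (suc n) (suc k) * t (suc k))
    ≡⟨ cong₂ _+_ (ℚP.*-identityˡ (t 0)) (sum-cong n (λ k _ → pascal k)) ⟩
  t 0 + sumTo n (λ k → binomℚ n k * t (suc k) + binomℚ n (suc k) * t (suc k))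
    ≡⟨ cong (_+_ (t 0)) (sum-+ n _ _) ⟩
  t 0 + (Shifted + Upper)
    ≡⟨ solve 3 (λ a b c → a :+ (b :+ c) := (a :+ c) :+ b) refl (t 0) Shifted Upper ⟩
  (t 0 + Upper) + Shifted
    ≡⟨ cong (_+ Shifted) first+upper ⟩
  Same + Shifted ∎
  where
  open ≡-Reasoning
  Shifted Upper Same : ℚ
  Shifted = sumTo n (λ k → binomℚ n k * t (suc k))
  Upper = sumTo n (λ k → binomℚ n (suc k) * t (suc k))
  Same = sumTo n (λ k → binomℚ n k * t k)
  pascal : ∀ k → binomℚ (suc n) (suc k) * t (suc k) ≡ binomℚ n k * t (suc k) + binomℚ n (suc k) * t (suc k)
  pascal k = begin
    nℚ (suc n C suc k) * t (suc k)                  ≡⟨ cong (λ m → nℚ m * t (suc k)) (sym (nCk+nC[k+1]≡[n+1]C[k+1] n k)) ⟩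
    nℚ ((n C k) ℕ.+ (n C suc k)) * t (suc k)        ≡⟨ cong (_* t (suc k)) (nℚ-+ (n C k) (n C suc k)) ⟩
    (binomℚ n k + binomℚ n (suc k)) * t (suc k)     ≡⟨ ℚP.*-distribʳ-+ (t (suc k)) (binomℚ n k) (binomℚ n (suc k)) ⟩
    binomℚ n k * t (suc k) + binomℚ n (suc k) * t (suc k) ∎
  first+upper : t 0 + Upper ≡ Same
  first+upper = begin
    t 0 + Upper                                  ≡⟨ cong (_+ Upper) (sym (ℚP.*-identityˡ (t 0))) ⟩
    binomℚ n 0 * t 0 + Upper                     ≡⟨ sym (sum-shift n (λ k → binomℚ n k * t k)) ⟩
    Same + binomℚ n (suc n) * t (suc n)          ≡⟨ cong (λ m → Same + nℚ m * t (suc n)) (k>n⇒nCk≡0 (ℕP.n<1+n n)) ⟩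
    Same + 0ℚ * t (suc n)                        ≡⟨ cong (_+_ Same) (ℚP.*-zeroˡ (t (suc n))) ⟩
    Same + 0ℚ                                    ≡⟨ ℚP.+-identityʳ Same ⟩
    Same                                         ∎

binomial-theorem : ∀ m z → (1ℚ + z) ^ℚ m ≡ sumTo m (λ j → binomℚ m j * (z ^ℚ j))
binomial-theorem zero z = refl
binomial-theorem (suc m) z = sym (begin
  sumTo (suc m) (λ j → binomℚ (suc m) j * (z ^ℚ j))  ≡⟨ pascal-sum m (z ^ℚ_) ⟩
  S + sumTo m (λ j → binomℚ m j * (z * (z ^ℚ j)))     ≡⟨ cong (_+_ S) (trans (sum-cong m (λ j _ → pull-z j)) (sum-scale m z _)) ⟩
  S + z * S                                          ≡⟨ solve 2 (λ s z → s :+ z :* s := (con 1ℚ :+ z) :* s) refl S z ⟩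
  (1ℚ + z) * S                                       ≡⟨ cong (_*_ (1ℚ + z)) (sym (binomial-theorem m z)) ⟩
  (1ℚ + z) * ((1ℚ + z) ^ℚ m)                         ∎)
  where
  open ≡-Reasoning
  S : ℚ
  S = sumTo m (λ j → binomℚ m j * (z ^ℚ j))
  pull-z : ∀ j → binomℚ m j * (z * (z ^ℚ j)) ≡ z * (binomℚ m j * (z ^ℚ j))
  pull-z j = solve 3 (λ a b c → a :* (b :* c) := b :* (a :* c)) refl (binomℚ m j) z (z ^ℚ j)

gbinom : ℚ → ℕ → ℚ
gbinom β zero = 1ℚ
gbinom β (suc j) = gbinom β j * (β - nℚ j) * inv (nℚ (suc j))

binom-absorption : ∀ m j → nℚ (suc j) * binomℚ m (suc j) ≡ (nℚ m - nℚ j) * binomℚ m j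
binom-absorption zero zero = refl
binom-absorption zero (suc j) = trans (ℚP.*-zeroʳ (nℚ (suc (suc j)))) (sym (ℚP.*-zeroʳ (nℚ 0 - nℚ (suc j))))
binom-absorption (suc m) zero = trans (cong (λ n → 1ℚ * nℚ n) (nC1≡n (suc m)))
  (solve 1 (λ M → con 1ℚ :* M := (M :- con 0ℚ) :* con 1ℚ) refl (nℚ (suc m)))
binom-absorption (suc m) (suc j) = begin
  J₂ * binomℚ (suc m) (suc (suc j))        ≡⟨ cong (λ n → J₂ * nℚ n) (sym (nCk+nC[k+1]≡[n+1]C[k+1] m (suc j))) ⟩
  J₂ * nℚ ((m C suc j) ℕ.+ (m C suc (suc j)))  ≡⟨ cong (_*_ J₂) (nℚ-+ (m C suc j) (m C suc (suc j))) ⟩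
  J₂ * (B₁ + B₂)                           ≡⟨ ℚP.*-distribˡ-+ J₂ B₁ B₂ ⟩
  J₂ * B₁ + J₂ * B₂                        ≡⟨ cong (_+_ (J₂ * B₁)) (binom-absorption m (suc j)) ⟩
  J₂ * B₁ + (M - J₁) * B₁                  ≡⟨ cong₂ (λ a b → a * B₁ + (M - b) * B₁) (trans (nℚ-suc (suc j)) (cong (_+_ 1ℚ) (nℚ-suc j))) (nℚ-suc j) ⟩
  (1ℚ + (1ℚ + J₀)) * B₁ + (M - (1ℚ + J₀)) * B₁
    ≡⟨ solve 3 (λ J₀ M B → (con 1ℚ :+ (con 1ℚ :+ J₀)) :* B :+ (M :- (con 1ℚ :+ J₀)) :* B := (con 1ℚ :+ J₀) :* B :+ (M :- J₀) :* B) refl J₀ M B₁ ⟩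
  (1ℚ + J₀) * B₁ + (M - J₀) * B₁             ≡⟨ cong (λ a → a * B₁ + (M - J₀) * B₁) (sym (nℚ-suc j)) ⟩
  J₁ * B₁ + (M - J₀) * B₁                   ≡⟨ cong (_+ (M - J₀) * B₁) (binom-absorption m j) ⟩
  (M - J₀) * B₀ + (M - J₀) * B₁              ≡⟨ sym (ℚP.*-distribˡ-+ (M - J₀) B₀ B₁) ⟩
  (M - J₀) * (B₀ + B₁)                      ≡⟨ cong₂ _*_ shift (sym (nℚ-+ (m C j) (m C suc j))) ⟩
  (nℚ (suc m) - J₁) * nℚ ((m C j) ℕ.+ (m C suc j)) ≡⟨ cong (λ n → (nℚ (suc m) - J₁) * nℚ n) (nCk+nC[k+1]≡[n+1]C[k+1] m j) ⟩
  (nℚ (suc m) - J₁) * binomℚ (suc m) (suc j) ∎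
  where
  open ≡-Reasoning
  J₀ J₁ J₂ M B₀ B₁ B₂ : ℚ
  J₀ = nℚ j
  J₁ = nℚ (suc j)
  J₂ = nℚ (suc (suc j))
  M = nℚ m
  B₀ = binomℚ m j
  B₁ = binomℚ m (suc j)
  B₂ = binomℚ m (suc (suc j))
  shift : M - J₀ ≡ nℚ (suc m) - J₁
  shift = trans (solve 2 (λ M J₀ → M :- J₀ := (con 1ℚ :+ M) :- (con 1ℚ :+ J₀)) refl M J₀)
                (sym (cong₂ _-_ (nℚ-suc m) (nℚ-suc j)))

binom≡gbinom : ∀ m j → binomℚ m j ≡ gbinom (nℚ m) j
binom≡gbinom m zero = refl
binom≡gbinom m (suc j) = *-cancelʳ (nℚ-suc≢0 j) (begin
  binomℚ m (suc j) * J₁           ≡⟨ ℚP.*-comm (binomℚ m (suc j)) J₁ ⟩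
  J₁ * binomℚ m (suc j)           ≡⟨ binom-absorption m j ⟩
  (nℚ m - nℚ j) * binomℚ m j      ≡⟨ cong (_*_ (nℚ m - nℚ j)) (binom≡gbinom m j) ⟩
  (nℚ m - nℚ j) * G               ≡⟨ solve 2 (λ a c → a :* c := c :* a :* con 1ℚ) refl (nℚ m - nℚ j) G ⟩
  G * (nℚ m - nℚ j) * 1ℚ          ≡⟨ cong (_*_ (G * (nℚ m - nℚ j))) (sym (inv-inverseˡ (nℚ-suc≢0 j))) ⟩
  G * (nℚ m - nℚ j) * (inv J₁ * J₁) ≡⟨ sym (ℚP.*-assoc (G * (nℚ m - nℚ j)) (inv J₁) J₁) ⟩
  gbinom (nℚ m) (suc j) * J₁      ∎)
  where
  open ≡-Reasoning
  J₁ : ℚ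
  J₁ = nℚ (suc j)
  G = gbinom (nℚ m) j

falling : ℚ → ℕ → ℚ
falling β zero = 1ℚ
falling β (suc n) = falling β n * (β - nℚ n)

gbinom-falling : ∀ β n → gbinom β n * nℚ (n !) ≡ falling β n
gbinom-falling β zero = refl
gbinom-falling β (suc n) = begin
  gbinom β n * (β - N) * inv N₁ * nℚ (suc n ℕ.* n !)  ≡⟨ cong (_*_ (gbinom β n * (β - N) * inv N₁)) (nℚ-* (suc n) (n !)) ⟩
  gbinom β n * (β - N) * inv N₁ * (N₁ * nℚ (n !))
    ≡⟨ solve 5 (λ c d i s f → c :* d :* i :* (s :* f) := (c :* f) :* d :* (i :* s)) refl (gbinom β n) (β - N) (inv N₁) N₁ (nℚ (n !)) ⟩
  (gbinom β n * nℚ (n !)) * (β - N) * (inv N₁ * N₁)   ≡⟨ cong₂ (λ u v → u * (β - N) * v) (gbinom-falling β n) (inv-inverseˡ (nℚ-suc≢0 n)) ⟩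
  falling β n * (β - N) * 1ℚ                          ≡⟨ ℚP.*-identityʳ _ ⟩
  falling β (suc n)                                   ∎
  where
  open ≡-Reasoning
  N N₁ : ℚ
  N = nℚ n
  N₁ = nℚ (suc n)

falling-+ : ∀ β k m → falling β (k ℕ.+ m) ≡ falling β k * falling (β - nℚ k) m
falling-+ β k zero = trans (cong (falling β) (ℕP.+-identityʳ k)) (sym (ℚP.*-identityʳ _))
falling-+ β k (suc m) = begin
  falling β (k ℕ.+ suc m)                            ≡⟨ cong (falling β) (ℕP.+-suc k m) ⟩
  falling β (k ℕ.+ m) * (β - nℚ (k ℕ.+ m))           ≡⟨ cong₂ (λ u v → u * (β - v)) (falling-+ β k m) (nℚ-+ k m) ⟩
  falling β k * falling (β - nℚ k) m * (β - (nℚ k + nℚ m))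
    ≡⟨ solve 5 (λ f g b k m → f :* g :* (b :- (k :+ m)) := f :* (g :* ((b :- k) :- m))) refl
         (falling β k) (falling (β - nℚ k) m) β (nℚ k) (nℚ m) ⟩
  falling β k * falling (β - nℚ k) (suc m)           ∎
  where open ≡-Reasoning

binom-factorials : ∀ {n k} → k ℕ.≤ n → binomℚ n k * (nℚ (k !) * nℚ ((n ∸ k) !)) ≡ nℚ (n !)
binom-factorials {n} {k} k≤n = begin
  binomℚ n k * (nℚ (k !) * nℚ ((n ∸ k) !))  ≡⟨ cong (_*_ (binomℚ n k)) (sym (nℚ-* (k !) ((n ∸ k) !))) ⟩
  binomℚ n k * nℚ (k ! ℕ.* (n ∸ k) !)       ≡⟨ sym (nℚ-* (n C k) _) ⟩
  nℚ ((n C k) ℕ.* (k ! ℕ.* (n ∸ k) !))     ≡⟨ cong nℚ in-ℕ ⟩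
  nℚ (n !)                                  ∎
  where
  open ≡-Reasoning
  in-ℕ : (n C k) ℕ.* (k ! ℕ.* (n ∸ k) !) ≡ n !
  in-ℕ = trans (cong (ℕ._* (k ! ℕ.* (n ∸ k) !)) (nCk≡n!/k![n-k]! k≤n))
               (m/n*n≡m {{k ℕP.!* (n ∸ k) !≢0}} (k![n∸k]!∣n! k≤n))

factorial≢0 : ∀ n → nℚ (n !) ≢ 0ℚ
factorial≢0 n = nℚ≢0 (ℕ.≢-nonZero⁻¹ (n !) {{n ℕP.!≢0}})

gbinom-subset : ∀ β k m → gbinom β (k ℕ.+ m) * binomℚ (k ℕ.+ m) k ≡ gbinom β k * gbinom (β - nℚ k) m
gbinom-subset β k m = *-cancelʳ (*-≢0 (factorial≢0 k) (factorial≢0 m)) (begin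
  gbinom β (k ℕ.+ m) * binomℚ (k ℕ.+ m) k * (K! * M!)
    ≡⟨ ℚP.*-assoc (gbinom β (k ℕ.+ m)) (binomℚ (k ℕ.+ m) k) (K! * M!) ⟩
  gbinom β (k ℕ.+ m) * (binomℚ (k ℕ.+ m) k * (K! * M!))
    ≡⟨ cong (λ n → gbinom β (k ℕ.+ m) * (binomℚ (k ℕ.+ m) k * (K! * nℚ (n !)))) (sym (ℕP.m+n∸m≡n k m)) ⟩
  gbinom β (k ℕ.+ m) * (binomℚ (k ℕ.+ m) k * (K! * nℚ ((k ℕ.+ m ∸ k) !)))
    ≡⟨ cong (_*_ (gbinom β (k ℕ.+ m))) (binom-factorials (ℕP.m≤m+n k m)) ⟩
  gbinom β (k ℕ.+ m) * nℚ ((k ℕ.+ m) !)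
    ≡⟨ gbinom-falling β (k ℕ.+ m) ⟩
  falling β (k ℕ.+ m)
    ≡⟨ falling-+ β k m ⟩
  falling β k * falling (β - nℚ k) m
    ≡⟨ cong₂ _*_ (sym (gbinom-falling β k)) (sym (gbinom-falling (β - nℚ k) m)) ⟩
  (gbinom β k * K!) * (gbinom (β - nℚ k) m * M!)
    ≡⟨ solve 4 (λ a b c d → (a :* b) :* (c :* d) := a :* c :* (b :* d)) refl (gbinom β k) K! (gbinom (β - nℚ k) m) M! ⟩
  gbinom β k * gbinom (β - nℚ k) m * (K! * M!) ∎)
  where
  open ≡-Reasoning
  K! M! : ℚ
  K! = nℚ (k !)
  M! = nℚ (m !)

half : ℚ
half = inv (nℚ 2)

quarter : ℚ
quarter = inv (nℚ 4)

negHalf : ℚ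
negHalf = - half

negThreeQuarters : ℚ
negThreeQuarters = - (nℚ 3 * quarter)

inv16 : ℚ
inv16 = inv (nℚ 16)

central : ℕ → ℚ
central k = binomℚ (4 ℕ.* k) (2 ℕ.* k) * (inv16 ^ℚ k)

falling-negHalf : ∀ j → falling negHalf j * nℚ (j !) * ((- nℚ 4) ^ℚ j) ≡ nℚ ((2 ℕ.* j) !)
falling-negHalf zero = refl
falling-negHalf (suc j) = begin
  falling negHalf j * (negHalf - N) * nℚ (suc j ℕ.* j !) * (- nℚ 4 * ((- nℚ 4) ^ℚ j))
    ≡⟨ cong (λ f → falling negHalf j * (negHalf - N) * f * (- nℚ 4 * ((- nℚ 4) ^ℚ j)))
         (trans (nℚ-* (suc j) (j !)) (cong (_* nℚ (j !)) (nℚ-suc j))) ⟩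
  falling negHalf j * (negHalf - N) * ((1ℚ + N) * nℚ (j !)) * (- nℚ 4 * ((- nℚ 4) ^ℚ j))
    ≡⟨ solve 4 (λ f N F P → f :* (con negHalf :- N) :* ((con 1ℚ :+ N) :* F) :* (con (- nℚ 4) :* P)
                          := (f :* F :* P) :* ((con negHalf :- N) :* (con 1ℚ :+ N) :* con (- nℚ 4)))
         refl (falling negHalf j) N (nℚ (j !)) ((- nℚ 4) ^ℚ j) ⟩
  (falling negHalf j * nℚ (j !) * ((- nℚ 4) ^ℚ j)) * ((negHalf - N) * (1ℚ + N) * - nℚ 4)
    ≡⟨ cong (_* ((negHalf - N) * (1ℚ + N) * - nℚ 4)) (falling-negHalf j) ⟩
  F₂ * ((negHalf - N) * (1ℚ + N) * - nℚ 4)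
    ≡⟨ solve 2 (λ F N → F :* ((con negHalf :- N) :* (con 1ℚ :+ N) :* con (- nℚ 4))
                      := (con 1ℚ :+ (con 1ℚ :+ (N :+ N))) :* ((con 1ℚ :+ (N :+ N)) :* F)) refl F₂ N ⟩
  (1ℚ + (1ℚ + (N + N))) * ((1ℚ + (N + N)) * F₂)
    ≡⟨ sym (cong₂ (λ a b → a * (b * F₂)) (trans (nℚ-suc (suc (2 ℕ.* j))) (cong (_+_ 1ℚ) odd)) odd) ⟩
  nℚ (suc (suc (2 ℕ.* j))) * (nℚ (suc (2 ℕ.* j)) * F₂)
    ≡⟨ sym (trans (nℚ-* (suc (suc (2 ℕ.* j))) (suc (2 ℕ.* j) !)) (cong (_*_ (nℚ (suc (suc (2 ℕ.* j))))) (nℚ-* (suc (2 ℕ.* j)) ((2 ℕ.* j) !)))) ⟩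
  nℚ (suc (suc (2 ℕ.* j)) !)
    ≡⟨ cong (λ n → nℚ (n !)) (sym (ℕP.*-suc 2 j)) ⟩
  nℚ ((2 ℕ.* suc j) !) ∎
  where
  open ≡-Reasoning
  N F₂ : ℚ
  N = nℚ j
  F₂ = nℚ ((2 ℕ.* j) !)
  odd : nℚ (suc (2 ℕ.* j)) ≡ 1ℚ + (N + N)
  odd = trans (nℚ-suc (2 ℕ.* j)) (cong (_+_ 1ℚ) (nℚ-double j))

central≡gbinom : ∀ k → central k ≡ gbinom negHalf (2 ℕ.* k)
central≡gbinom k = begin
  binomℚ (4 ℕ.* k) j * (inv16 ^ℚ k)                       ≡⟨ cong (_* (inv16 ^ℚ k)) binom-4k-2k ⟩
  gbinom negHalf j * (nℚ 16 ^ℚ k) * (inv16 ^ℚ k)           ≡⟨ ℚP.*-assoc (gbinom negHalf j) _ _ ⟩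
  gbinom negHalf j * ((nℚ 16 ^ℚ k) * (inv16 ^ℚ k))         ≡⟨ cong (_*_ (gbinom negHalf j)) (^ℚ-inverse k refl) ⟩
  gbinom negHalf j * 1ℚ                                    ≡⟨ ℚP.*-identityʳ _ ⟩
  gbinom negHalf j                                         ∎
  where
  open ≡-Reasoning
  j : ℕ
  j = 2 ℕ.* k
  F : ℚ
  F = nℚ (j !)
  4k≡j+j : 4 ℕ.* k ≡ j ℕ.+ j
  4k≡j+j = trans (ℕP.*-assoc 2 2 k) (cong (j ℕ.+_) (ℕP.+-identityʳ j))
  binom-4k-2k : binomℚ (4 ℕ.* k) j ≡ gbinom negHalf j * (nℚ 16 ^ℚ k)
  binom-4k-2k = *-cancelʳ (*-≢0 (factorial≢0 j) (factorial≢0 j)) (begin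
    binomℚ (4 ℕ.* k) j * (F * F)                       ≡⟨ cong (λ n → binomℚ (4 ℕ.* k) j * (F * nℚ (n !))) (sym (trans (cong (_∸ j) 4k≡j+j) (ℕP.m+n∸m≡n j j))) ⟩
    binomℚ (4 ℕ.* k) j * (F * nℚ ((4 ℕ.* k ∸ j) !))     ≡⟨ binom-factorials (subst (j ℕ.≤_) (sym 4k≡j+j) (ℕP.m≤m+n j j)) ⟩
    nℚ ((4 ℕ.* k) !)                                   ≡⟨ cong (λ n → nℚ (n !)) (ℕP.*-assoc 2 2 k) ⟩
    nℚ ((2 ℕ.* j) !)                                   ≡⟨ sym (falling-negHalf j) ⟩
    falling negHalf j * F * ((- nℚ 4) ^ℚ j)             ≡⟨ cong₂ (λ u v → u * F * v) (sym (gbinom-falling negHalf j)) (^ℚ-double (- nℚ 4) k) ⟩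
    gbinom negHalf j * F * F * (nℚ 16 ^ℚ k)             ≡⟨ solve 3 (λ c f s → c :* f :* f :* s := c :* s :* (f :* f)) refl (gbinom negHalf j) F (nℚ 16 ^ℚ k) ⟩
    gbinom negHalf j * (nℚ 16 ^ℚ k) * (F * F)           ∎)

poch : ℚ → ℕ → ℚ
poch c zero = 1ℚ
poch c (suc k) = c * poch (c + 1ℚ) k

poch-suc : ∀ c k → poch c (suc k) ≡ poch c k * (c + nℚ k)
poch-suc c zero = solve 1 (λ c → c :* con 1ℚ := con 1ℚ :* (c :+ con 0ℚ)) refl c
poch-suc c (suc k) = begin
  c * poch (c + 1ℚ) (suc k)                    ≡⟨ cong (_*_ c) (poch-suc (c + 1ℚ) k) ⟩
  c * (poch (c + 1ℚ) k * ((c + 1ℚ) + nℚ k))    ≡⟨ solve 3 (λ c P N → c :* (P :* ((c :+ con 1ℚ) :+ N)) := c :* P :* (c :+ (con 1ℚ :+ N))) refl c (poch (c + 1ℚ) k) (nℚ k) ⟩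
  c * poch (c + 1ℚ) k * (c + (1ℚ + nℚ k))      ≡⟨ cong (λ n → c * poch (c + 1ℚ) k * (c + n)) (sym (nℚ-suc k)) ⟩
  poch c (suc k) * (c + nℚ (suc k))            ∎
  where open ≡-Reasoning

record NoPole (c : ℚ) : Set where
  constructor noPole
  field avoids : ∀ i → c + nℚ i ≢ 0ℚ

NoPole-suc : ∀ {c} → NoPole c → NoPole (c + 1ℚ)
NoPole-suc {c} (noPole avoids) = noPole (λ i e →
  avoids (suc i) (trans (trans (cong (_+_ c) (nℚ-suc i)) (sym (ℚP.+-assoc c 1ℚ (nℚ i)))) e))

NoPole⇒≢0 : ∀ {c} → NoPole c → c ≢ 0ℚ
NoPole⇒≢0 {c} (noPole avoids) e = avoids 0 (trans (ℚP.+-identityʳ c) e)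

poch≢0 : ∀ {c} k → NoPole c → poch c k ≢ 0ℚ
poch≢0 zero c-ok ()
poch≢0 {c} (suc k) c-ok = *-≢0 {c} (NoPole⇒≢0 c-ok) (poch≢0 k (NoPole-suc c-ok))

ratio : ℚ → ℚ → ℕ → ℚ
ratio b c k = poch b k * inv (poch c k)

ratio-suc-front : ∀ b c k → ratio b c (suc k) ≡ (b * inv c) * ratio (b + 1ℚ) (c + 1ℚ) k
ratio-suc-front b c k = trans (cong (_*_ (b * poch (b + 1ℚ) k)) (inv-* c (poch (c + 1ℚ) k)))
  (solve 4 (λ b P i j → b :* P :* (i :* j) := b :* i :* (P :* j)) refl b (poch (b + 1ℚ) k) (inv c) (inv (poch (c + 1ℚ) k)))

ratio-suc : ∀ b c k → ratio b c (suc k) ≡ ratio b c k * (b + nℚ k) * inv (c + nℚ k)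
ratio-suc b c k = trans (cong₂ (λ u v → u * inv v) (poch-suc b k) (poch-suc c k))
  (trans (cong (_*_ (poch b k * (b + nℚ k))) (inv-* (poch c k) (c + nℚ k)))
  (solve 4 (λ P B I J → P :* B :* (I :* J) := P :* I :* B :* J) refl (poch b k) (b + nℚ k) (inv (poch c k)) (inv (c + nℚ k))))

-- Multiply by
-- (c)ₙ₊₁, which is both (c)ₙ·(c+n) and, by definition, c·(c+1)ₙ.
ratio-contiguous : ∀ b c n → NoPole c →
  ratio (c - b) c n + (- (b * inv c)) * ratio (c - b) (c + 1ℚ) n ≡ ratio (c - b) c (suc n)
ratio-contiguous b c n c-ok = *-cancelʳ Q≢0 (begin
  (D * inv Pc + (- (b * inv c)) * (D * inv P)) * Q
    ≡⟨ ℚP.*-distribʳ-+ Q (D * inv Pc) _ ⟩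
  D * inv Pc * Q + (- (b * inv c)) * (D * inv P) * (c * P)
    ≡⟨ cong (λ q → D * inv Pc * q + (- (b * inv c)) * (D * inv P) * (c * P)) (poch-suc c n) ⟩
  D * inv Pc * (Pc * (c + N)) + (- (b * inv c)) * (D * inv P) * (c * P)
    ≡⟨ solve 9 (λ D iPc Pc c N b ic iP P → D :* iPc :* (Pc :* (c :+ N)) :+ (:- (b :* ic)) :* (D :* iP) :* (c :* P)
                 := D :* (c :+ N) :* (iPc :* Pc) :- b :* D :* ((ic :* c) :* (iP :* P))) refl D (inv Pc) Pc c N b (inv c) (inv P) P ⟩
  D * (c + N) * (inv Pc * Pc) - b * D * ((inv c * c) * (inv P * P))
    ≡⟨ cong₂ (λ u v → D * (c + N) * u - b * D * v) (inv-inverseˡ (poch≢0 n c-ok))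
         (cong₂ _*_ (inv-inverseˡ (NoPole⇒≢0 c-ok)) (inv-inverseˡ (poch≢0 n (NoPole-suc c-ok)))) ⟩
  D * (c + N) * 1ℚ - b * D * (1ℚ * 1ℚ)
    ≡⟨ solve 4 (λ D c N b → D :* (c :+ N) :* con 1ℚ :- b :* D :* (con 1ℚ :* con 1ℚ) := D :* ((c :- b) :+ N) :* con 1ℚ) refl D c N b ⟩
  D * (d + N) * 1ℚ
    ≡⟨ cong (_*_ (D * (d + N))) (sym (inv-inverseˡ Q≢0)) ⟩
  D * (d + N) * (inv Q * Q)
    ≡⟨ sym (ℚP.*-assoc (D * (d + N)) (inv Q) Q) ⟩
  D * (d + N) * inv Q * Q
    ≡⟨ cong (λ r → r * inv Q * Q) (sym (poch-suc d n)) ⟩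
  ratio d c (suc n) * Q ∎)
  where
  open ≡-Reasoning
  d D Pc P N Q : ℚ
  d = c - b
  D = poch d n
  Pc = poch c n
  P = poch (c + 1ℚ) n
  N = nℚ n
  Q = poch c (suc n)
  Q≢0 : Q ≢ 0ℚ
  Q≢0 = poch≢0 (suc n) c-ok

chu-vandermonde : ∀ n b c → NoPole c → sumTo n (λ k → binomℚ n k * (sgn k * ratio b c k)) ≡ ratio (c - b) c n
chu-vandermonde zero b c c-ok = refl
chu-vandermonde (suc n) b c c-ok = begin
  sumTo (suc n) (λ k → binomℚ (suc n) k * t k)
    ≡⟨ pascal-sum n t ⟩
  sumTo n (λ k → binomℚ n k * t k) + sumTo n (λ k → binomℚ n k * t (suc k))
    ≡⟨ cong₂ _+_ (chu-vandermonde n b c c-ok) (trans (sum-cong n (λ k _ → shifted-term k)) (sum-scale n (- (b * inv c)) _)) ⟩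
  ratio d c n + (- (b * inv c)) * sumTo n (λ k → binomℚ n k * (sgn k * ratio (b + 1ℚ) (c + 1ℚ) k))
    ≡⟨ cong (λ s → ratio d c n + (- (b * inv c)) * s)
         (trans (chu-vandermonde n (b + 1ℚ) (c + 1ℚ) (NoPole-suc c-ok)) (cong (λ e → ratio e (c + 1ℚ) n) same-difference)) ⟩
  ratio d c n + (- (b * inv c)) * ratio d (c + 1ℚ) n
    ≡⟨ ratio-contiguous b c n c-ok ⟩
  ratio d c (suc n) ∎
  where
  open ≡-Reasoning
  d : ℚ
  d = c - b
  t : ℕ → ℚ
  t k = sgn k * ratio b c k
  shifted-term : ∀ k → binomℚ n k * t (suc k) ≡ (- (b * inv c)) * (binomℚ n k * (sgn k * ratio (b + 1ℚ) (c + 1ℚ) k))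
  shifted-term k = trans (cong (λ r → binomℚ n k * ((- 1ℚ) * sgn k * r)) (ratio-suc-front b c k))
    (solve 4 (λ B s bi r → B :* (con (- 1ℚ) :* s :* (bi :* r)) := (:- bi) :* (B :* (s :* r))) refl
       (binomℚ n k) (sgn k) (b * inv c) (ratio (b + 1ℚ) (c + 1ℚ) k))
  same-difference : (c + 1ℚ) - (b + 1ℚ) ≡ c - b
  same-difference = solve 2 (λ c b → (c :+ con 1ℚ) :- (b :+ con 1ℚ) := c :- b) refl c b

half-+ : ∀ K → half + K ≡ half * (1ℚ + (K + K))
half-+ = solve 1 (λ K → con half :+ K := con half :* (con 1ℚ :+ (K :+ K))) refl

half-NoPole : NoPole half
half-NoPole = noPole (λ i e → *-≢0 {half} (λ ()) (odd≢0 i) (trans (sym (half-+ (nℚ i))) e))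
  where
  odd≢0 : ∀ i → 1ℚ + (nℚ i + nℚ i) ≢ 0ℚ
  odd≢0 i e = nℚ-suc≢0 (2 ℕ.* i) (trans (trans (nℚ-suc (2 ℕ.* i)) (cong (_+_ 1ℚ) (nℚ-double i))) e)

central-hypergeometric : ∀ k → gbinom negHalf (2 ℕ.* k) ≡ sgn k * gbinom negThreeQuarters k * ratio quarter half k
central-hypergeometric zero = refl
central-hypergeometric (suc k) = begin
  gbinom negHalf (2 ℕ.* suc k)
    ≡⟨ cong (gbinom negHalf) (ℕP.*-suc 2 k) ⟩
  gbinom negHalf (2 ℕ.* k) * (negHalf - nℚ (2 ℕ.* k)) * inv O * (negHalf - O) * inv (nℚ (suc (suc (2 ℕ.* k))))
    ≡⟨ cong₂ (λ u v → u * (negHalf - nℚ (2 ℕ.* k)) * inv O * (negHalf - O) * v) (central-hypergeometric k) inv-even ⟩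
  X * (negHalf - nℚ (2 ℕ.* k)) * inv O * (negHalf - O) * (half * i₂)
    ≡⟨ cong₂ (λ u v → X * (negHalf - u) * inv v * (negHalf - v) * (half * i₂)) (nℚ-double k) odd ⟩
  X * (negHalf - (K + K)) * i₁ * (negHalf - (1ℚ + (K + K))) * (half * i₂)
    ≡⟨ solve 6 (λ s C Rk K i₁ i₂ → s :* C :* Rk :* (con negHalf :- (K :+ K)) :* i₁ :* (con negHalf :- (con 1ℚ :+ (K :+ K))) :* (con half :* i₂)
                 := (con (- 1ℚ) :* s) :* (C :* (con negThreeQuarters :- K) :* i₂) :* (Rk :* (con quarter :+ K) :* (con (nℚ 2) :* i₁)))
         refl (sgn k) (gbinom negThreeQuarters k) (ratio quarter half k) K i₁ i₂ ⟩
  sgn (suc k) * (gbinom negThreeQuarters k * (negThreeQuarters - K) * i₂) * (ratio quarter half k * (quarter + K) * (nℚ 2 * i₁))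
    ≡⟨ cong₂ (λ u v → sgn (suc k) * (gbinom negThreeQuarters k * (negThreeQuarters - K) * u) * (ratio quarter half k * (quarter + K) * v))
         (sym (cong inv (nℚ-suc k))) (sym inv-half+K) ⟩
  sgn (suc k) * gbinom negThreeQuarters (suc k) * (ratio quarter half k * (quarter + K) * inv (half + K))
    ≡⟨ cong (_*_ (sgn (suc k) * gbinom negThreeQuarters (suc k))) (sym (ratio-suc quarter half k)) ⟩
  sgn (suc k) * gbinom negThreeQuarters (suc k) * ratio quarter half (suc k) ∎
  where
  open ≡-Reasoning
  K O X i₁ i₂ : ℚ
  K = nℚ k
  O = nℚ (suc (2 ℕ.* k))
  X = sgn k * gbinom negThreeQuarters k * ratio quarter half k
  i₁ = inv (1ℚ + (K + K))
  i₂ = inv (1ℚ + K)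
  odd : O ≡ 1ℚ + (K + K)
  odd = trans (nℚ-suc (2 ℕ.* k)) (cong (_+_ 1ℚ) (nℚ-double k))
  inv-even : inv (nℚ (suc (suc (2 ℕ.* k)))) ≡ half * i₂
  inv-even = trans (cong inv (trans (nℚ-suc (suc (2 ℕ.* k))) (trans (cong (_+_ 1ℚ) odd)
                 (solve 1 (λ K → con 1ℚ :+ (con 1ℚ :+ (K :+ K)) := con (nℚ 2) :* (con 1ℚ :+ K)) refl K))))
             (inv-* (nℚ 2) (1ℚ + K))
  inv-half+K : inv (half + K) ≡ nℚ 2 * i₁
  inv-half+K = trans (cong inv (half-+ K))
                     (inv-* half (1ℚ + (K + K)))

-- By `gbinom-subset` the left
-- side is C(-3/4, n) times a Chu–Vandermonde sum with b = 1/4, c = 1/2, whose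
-- value (c-b)ₙ/(c)ₙ = (1/4)ₙ/(1/2)ₙ closes up by `central-hypergeometric`.
central-convolution : ∀ n → sumTo n (λ k → central k * gbinom (negThreeQuarters - nℚ k) (n ∸ k)) ≡ sgn n * central n
central-convolution n = begin
  sumTo n (λ k → central k * gbinom (negThreeQuarters - nℚ k) (n ∸ k))
    ≡⟨ sum-cong n term ⟩
  sumTo n (λ k → C n * (binomℚ n k * (sgn k * ratio quarter half k)))
    ≡⟨ sum-scale n (C n) _ ⟩
  C n * sumTo n (λ k → binomℚ n k * (sgn k * ratio quarter half k))
    ≡⟨ cong (_*_ (C n)) (chu-vandermonde n quarter half half-NoPole) ⟩
  C n * ratio quarter half n
    ≡⟨ sym (ℚP.*-identityˡ _) ⟩
  1ℚ * (C n * ratio quarter half n)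
    ≡⟨ cong (_* (C n * ratio quarter half n)) (sym (sgn-square n)) ⟩
  sgn n * sgn n * (C n * ratio quarter half n)
    ≡⟨ solve 3 (λ s C r → s :* s :* (C :* r) := s :* (s :* C :* r)) refl (sgn n) (C n) (ratio quarter half n) ⟩
  sgn n * (sgn n * C n * ratio quarter half n)
    ≡⟨ cong (_*_ (sgn n)) (sym (A-hyp n)) ⟩
  sgn n * central n ∎
  where
  open ≡-Reasoning
  C : ℕ → ℚ
  C = gbinom negThreeQuarters
  A-hyp : ∀ k → central k ≡ sgn k * C k * ratio quarter half k
  A-hyp k = trans (central≡gbinom k) (central-hypergeometric k)
  term : ∀ k → k ℕ.≤ n → central k * gbinom (negThreeQuarters - nℚ k) (n ∸ k) ≡ C n * (binomℚ n k * (sgn k * ratio quarter half k))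
  term k k≤n = begin
    central k * gbinom (negThreeQuarters - nℚ k) (n ∸ k)
      ≡⟨ cong (_* gbinom (negThreeQuarters - nℚ k) (n ∸ k)) (A-hyp k) ⟩
    sgn k * C k * ratio quarter half k * gbinom (negThreeQuarters - nℚ k) (n ∸ k)
      ≡⟨ solve 4 (λ s a r b → s :* a :* r :* b := (a :* b) :* (s :* r)) refl (sgn k) (C k) (ratio quarter half k) (gbinom (negThreeQuarters - nℚ k) (n ∸ k)) ⟩
    (C k * gbinom (negThreeQuarters - nℚ k) (n ∸ k)) * (sgn k * ratio quarter half k)
      ≡⟨ cong (_* (sgn k * ratio quarter half k)) (sym (gbinom-subset negThreeQuarters k (n ∸ k))) ⟩
    (C (k ℕ.+ (n ∸ k)) * binomℚ (k ℕ.+ (n ∸ k)) k) * (sgn k * ratio quarter half k)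
      ≡⟨ cong (λ m → (C m * binomℚ m k) * (sgn k * ratio quarter half k)) (ℕP.m+[n∸m]≡n k≤n) ⟩
    (C n * binomℚ n k) * (sgn k * ratio quarter half k)
      ≡⟨ ℚP.*-assoc (C n) (binomℚ n k) _ ⟩
    C n * (binomℚ n k * (sgn k * ratio quarter half k)) ∎

centralSum : ℕ → ℚ → ℚ
centralSum q z = sumTo q (λ k → central k * (z ^ℚ k))

series-scaled : ∀ q x →
  sumTo q (λ k → binomℚ (4 ℕ.* k) (2 ℕ.* k) * ((x * inv (nℚ 16)) ^ℚ k)) ≡ centralSum q x
series-scaled q x = sum-cong q (λ k _ → trans (cong (_*_ (binomℚ (4 ℕ.* k) (2 ℕ.* k))) (^ℚ-distrib-* x inv16 k))
  (solve 3 (λ b u v → b :* (u :* v) := b :* v :* u) refl (binomℚ (4 ℕ.* k) (2 ℕ.* k)) (x ^ℚ k) (inv16 ^ℚ k)))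

series-inverse : ∀ q z →
  sumTo q (λ k → binomℚ (4 ℕ.* k) (2 ℕ.* k) * inv ((nℚ 16 * z) ^ℚ k)) ≡ centralSum q (inv z)
series-inverse q z = sum-cong q (λ k _ → begin
  B k * inv ((nℚ 16 * z) ^ℚ k)              ≡⟨ cong (λ u → B k * inv u) (^ℚ-distrib-* (nℚ 16) z k) ⟩
  B k * inv ((nℚ 16 ^ℚ k) * (z ^ℚ k))       ≡⟨ cong (_*_ (B k)) (trans (inv-* (nℚ 16 ^ℚ k) (z ^ℚ k)) (cong₂ _*_ (inv-^ℚ (nℚ 16) k) (inv-^ℚ z k))) ⟩
  B k * ((inv16 ^ℚ k) * (inv z ^ℚ k))       ≡⟨ sym (ℚP.*-assoc (B k) (inv16 ^ℚ k) (inv z ^ℚ k)) ⟩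
  central k * (inv z ^ℚ k)                  ∎)
  where
  open ≡-Reasoning
  B : ℕ → ℚ
  B k = binomℚ (4 ℕ.* k) (2 ℕ.* k)

even-binomial-palindrome : ∀ q {x y} → x * y ≡ 1ℚ →
  (x ^ℚ q) * sumTo q (λ k → binomℚ (2 ℕ.* q) (2 ℕ.* k) * (y ^ℚ k)) ≡ sumTo q (λ k → binomℚ (2 ℕ.* q) (2 ℕ.* k) * (x ^ℚ k))
even-binomial-palindrome q {x} {y} xy≡1 = begin
  (x ^ℚ q) * sumTo q (λ k → B k * (y ^ℚ k))    ≡⟨ sym (sum-scale q (x ^ℚ q) _) ⟩
  sumTo q (λ k → (x ^ℚ q) * (B k * (y ^ℚ k)))  ≡⟨ sum-cong q reflect ⟩
  sumTo q (λ k → f (q ∸ k))                    ≡⟨ sym (sum-reverse q f) ⟩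
  sumTo q f                                    ∎
  where
  open ≡-Reasoning
  B : ℕ → ℚ
  B k = binomℚ (2 ℕ.* q) (2 ℕ.* k)
  f : ℕ → ℚ
  f k = B k * (x ^ℚ k)
  symmetric : ∀ {k} → k ℕ.≤ q → B k ≡ B (q ∸ k)
  symmetric {k} k≤q = cong nℚ (trans (nCk≡nC[n∸k] (ℕP.*-monoʳ-≤ 2 k≤q)) (cong ((2 ℕ.* q) C_) (sym (ℕP.*-distribˡ-∸ 2 q k))))
  reflect : ∀ k → k ℕ.≤ q → (x ^ℚ q) * (B k * (y ^ℚ k)) ≡ f (q ∸ k)
  reflect k k≤q = begin
    (x ^ℚ q) * (B k * (y ^ℚ k))                         ≡⟨ cong (_* (B k * (y ^ℚ k))) (^ℚ-split x k≤q) ⟩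
    (x ^ℚ (q ∸ k)) * (x ^ℚ k) * (B k * (y ^ℚ k))        ≡⟨ solve 4 (λ a b c d → a :* b :* (c :* d) := c :* a :* (b :* d)) refl (x ^ℚ (q ∸ k)) (x ^ℚ k) (B k) (y ^ℚ k) ⟩
    B k * (x ^ℚ (q ∸ k)) * ((x ^ℚ k) * (y ^ℚ k))        ≡⟨ cong (_*_ (B k * (x ^ℚ (q ∸ k)))) (^ℚ-inverse k xy≡1) ⟩
    B k * (x ^ℚ (q ∸ k)) * 1ℚ                           ≡⟨ ℚP.*-identityʳ _ ⟩
    B k * (x ^ℚ (q ∸ k))                                ≡⟨ cong (_* (x ^ℚ (q ∸ k))) (symmetric k≤q) ⟩
    f (q ∸ k)                                           ∎

-- For y = 1/x: (1-y)^q S_q(1/(1-x)) = Σ_{k≤q} A k (-y)ᵏ (1-y)^{q-k},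
-- since 1/(1-x) = -y/(1-y).
expand-shifted-series : ∀ q {x y} → x * y ≡ 1ℚ → 1ℚ - y ≢ 0ℚ →
  ((1ℚ - y) ^ℚ q) * centralSum q (inv (1ℚ - x)) ≡ sumTo q (λ k → central k * (((- y) ^ℚ k) * ((1ℚ - y) ^ℚ (q ∸ k))))
expand-shifted-series q {x} {y} xy≡1 u≢0 = begin
  (u ^ℚ q) * centralSum q (inv (1ℚ - x))                  ≡⟨ sym (sum-scale q (u ^ℚ q) _) ⟩
  sumTo q (λ k → (u ^ℚ q) * (central k * (inv (1ℚ - x) ^ℚ k)))
                                                          ≡⟨ sum-cong q term ⟩
  sumTo q (λ k → central k * (((- y) ^ℚ k) * (u ^ℚ (q ∸ k)))) ∎
  where
  open ≡-Reasoning
  u : ℚ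
  u = 1ℚ - y
  inv-1-x : inv (1ℚ - x) ≡ (- y) * inv u
  inv-1-x = inv-unique {1ℚ - x} (begin
    (1ℚ - x) * ((- y) * inv u)  ≡⟨ solve 3 (λ x y i → (con 1ℚ :- x) :* ((:- y) :* i) := (x :* y :- y) :* i) refl x y (inv u) ⟩
    (x * y - y) * inv u         ≡⟨ cong (λ t → (t - y) * inv u) xy≡1 ⟩
    u * inv u                   ≡⟨ inv-inverseʳ u≢0 ⟩
    1ℚ                          ∎)
  term : ∀ k → k ℕ.≤ q → (u ^ℚ q) * (central k * (inv (1ℚ - x) ^ℚ k)) ≡ central k * (((- y) ^ℚ k) * (u ^ℚ (q ∸ k)))
  term k k≤q = begin
    (u ^ℚ q) * (central k * (inv (1ℚ - x) ^ℚ k))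
      ≡⟨ cong₂ (λ a b → a * (central k * (b ^ℚ k))) (^ℚ-split u k≤q) inv-1-x ⟩
    (u ^ℚ (q ∸ k)) * (u ^ℚ k) * (central k * (((- y) * inv u) ^ℚ k))
      ≡⟨ cong (λ t → (u ^ℚ (q ∸ k)) * (u ^ℚ k) * (central k * t)) (^ℚ-distrib-* (- y) (inv u) k) ⟩
    (u ^ℚ (q ∸ k)) * (u ^ℚ k) * (central k * (((- y) ^ℚ k) * (inv u ^ℚ k)))
      ≡⟨ solve 5 (λ a b c d e → a :* b :* (c :* (d :* e)) := c :* (d :* a) :* (b :* e)) refl (u ^ℚ (q ∸ k)) (u ^ℚ k) (central k) ((- y) ^ℚ k) (inv u ^ℚ k) ⟩
    central k * (((- y) ^ℚ k) * (u ^ℚ (q ∸ k))) * ((u ^ℚ k) * (inv u ^ℚ k))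
      ≡⟨ cong (_*_ (central k * (((- y) ^ℚ k) * (u ^ℚ (q ∸ k))))) (^ℚ-inverse k (inv-inverseʳ u≢0)) ⟩
    central k * (((- y) ^ℚ k) * (u ^ℚ (q ∸ k))) * 1ℚ
      ≡⟨ ℚP.*-identityʳ _ ⟩
    central k * (((- y) ^ℚ k) * (u ^ℚ (q ∸ k))) ∎

-- Collecting powers of z = -y in Σ_k A k zᵏ Σ_{j≤q-k} C(-3/4-k, j) zʲ: by
-- `central-convolution` the coefficient of zⁿ is (-1)ⁿ A n, so the double
-- sum equals S_q(y).
collect-convolution : ∀ q y →
  sumTo q (λ k → central k * (((- y) ^ℚ k) * sumTo (q ∸ k) (λ j → gbinom (negThreeQuarters - nℚ k) j * ((- y) ^ℚ j))))
    ≡ centralSum q y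
collect-convolution q y = begin
  sumTo q (λ k → central k * ((z ^ℚ k) * sumTo (q ∸ k) (λ j → G k j * (z ^ℚ j))))
    ≡⟨ sum-cong q (λ k _ → trans (sym (ℚP.*-assoc (central k) (z ^ℚ k) _)) (sym (sum-scale (q ∸ k) (central k * (z ^ℚ k)) _))) ⟩
  sumTo q (λ k → sumTo (q ∸ k) (λ j → (central k * (z ^ℚ k)) * (G k j * (z ^ℚ j))))
    ≡⟨ sum-triangle q (λ k j → (central k * (z ^ℚ k)) * (G k j * (z ^ℚ j))) ⟩
  sumTo q (λ n → sumTo n (λ k → (central k * (z ^ℚ k)) * (G k (n ∸ k) * (z ^ℚ (n ∸ k)))))
    ≡⟨ sum-cong q (λ n _ → trans (sum-cong n (λ k k≤n → factor-power n k k≤n)) (sum-scale n (z ^ℚ n) _)) ⟩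
  sumTo q (λ n → (z ^ℚ n) * sumTo n (λ k → central k * G k (n ∸ k)))
    ≡⟨ sum-cong q (λ n _ → cong (_*_ (z ^ℚ n)) (central-convolution n)) ⟩
  sumTo q (λ n → (z ^ℚ n) * (sgn n * central n))
    ≡⟨ sum-cong q (λ n _ → sign-cancels n) ⟩
  centralSum q y ∎
  where
  open ≡-Reasoning
  z : ℚ
  z = - y
  G : ℕ → ℕ → ℚ
  G k j = gbinom (negThreeQuarters - nℚ k) j
  factor-power : ∀ n k → k ℕ.≤ n →
    (central k * (z ^ℚ k)) * (G k (n ∸ k) * (z ^ℚ (n ∸ k))) ≡ (z ^ℚ n) * (central k * G k (n ∸ k))
  factor-power n k k≤n = begin
    (central k * (z ^ℚ k)) * (G k (n ∸ k) * (z ^ℚ (n ∸ k)))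
      ≡⟨ solve 4 (λ a b c d → (a :* b) :* (c :* d) := (d :* b) :* (a :* c)) refl (central k) (z ^ℚ k) (G k (n ∸ k)) (z ^ℚ (n ∸ k)) ⟩
    ((z ^ℚ (n ∸ k)) * (z ^ℚ k)) * (central k * G k (n ∸ k))
      ≡⟨ cong (_* (central k * G k (n ∸ k))) (sym (^ℚ-split z k≤n)) ⟩
    (z ^ℚ n) * (central k * G k (n ∸ k)) ∎
  sign-cancels : ∀ n → (z ^ℚ n) * (sgn n * central n) ≡ central n * (y ^ℚ n)
  sign-cancels n = begin
    (z ^ℚ n) * (sgn n * central n)             ≡⟨ cong (_* (sgn n * central n)) (neg-^ℚ y n) ⟩
    sgn n * (y ^ℚ n) * (sgn n * central n)     ≡⟨ solve 3 (λ s u a → s :* u :* (s :* a) := (s :* s) :* (a :* u)) refl (sgn n) (y ^ℚ n) (central n) ⟩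
    (sgn n * sgn n) * (central n * (y ^ℚ n))   ≡⟨ cong (_* (central n * (y ^ℚ n))) (sgn-square n) ⟩
    1ℚ * (central n * (y ^ℚ n))                ≡⟨ ℚP.*-identityˡ _ ⟩
    central n * (y ^ℚ n)                       ∎

division-identity : ∀ n d .{{_ : ℕ.NonZero d}} {r} → n % d ≡ r → n ≡ r ℕ.+ (n / d) ℕ.* d
division-identity n d n%d≡r = trans (m≡m%n+[m/n]*n n d) (cong (ℕ._+ (n / d) ℕ.* d) n%d≡r)

quotient-after-remainder : ∀ n d .{{_ : ℕ.NonZero d}} {r} → n % d ≡ r → (n ∸ r) / d ≡ n / d
quotient-after-remainder n d {r} n%d≡r = begin
  (n ∸ r) / d                          ≡⟨ cong (λ t → (t ∸ r) / d) (division-identity n d n%d≡r) ⟩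
  (r ℕ.+ (n / d) ℕ.* d ∸ r) / d        ≡⟨ cong (_/ d) (ℕP.m+n∸m≡n r ((n / d) ℕ.* d)) ⟩
  (n / d) ℕ.* d / d                    ≡⟨ m*n/n≡m (n / d) d ⟩
  n / d                                ∎
  where open ≡-Reasoning

module Modulo (p : ℕ) (p-prime : Prime p) where

  -- x ∈ ℤ₍ₚ₎ (wrapped in a record so that x can be inferred).
  record Integral (x : ℚ) : Set where
    constructor integral
    field p∤den : PIntegral p x
  open Integral public

  -- A presentation x = a/b with p ∤ b, not necessarily in lowest terms.
  record Fraction (x : ℚ) : Set where
    constructor fraction
    field
      numer denom : ℤ
      p∤denom : ¬ p ∣ ℤ.∣ denom ∣
      cleared : x * zℚ denom ≡ zℚ numer

  1<p : 1 ℕ.< p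
  1<p = ℕ.nonTrivial⇒n>1 p {{prime⇒nonTrivial p-prime}}

  p∤suc : ∀ {m} → suc m ℕ.< p → ¬ p ∣ suc m
  p∤suc m<p p∣m = ℕP.<⇒≱ m<p (∣⇒≤ p∣m)

  p∤-* : ∀ {a b} → ¬ p ∣ a → ¬ p ∣ b → ¬ p ∣ a ℕ.* b
  p∤-* {a} {b} p∤a p∤b p∣ab with euclidsLemma a b p-prime p∣ab
  ... | inj₁ p∣a = p∤a p∣a
  ... | inj₂ p∣b = p∤b p∣b

  p∤-*ℤ : ∀ a b → ¬ p ∣ ℤ.∣ a ∣ → ¬ p ∣ ℤ.∣ b ∣ → ¬ p ∣ ℤ.∣ a ℤ.* b ∣
  p∤-*ℤ a b p∤a p∤b = p∤-* p∤a p∤b ∘ subst (p ∣_) (ℤP.abs-* a b)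

  p∤⇒zℚ≢0 : ∀ b → ¬ p ∣ ℤ.∣ b ∣ → zℚ b ≢ 0ℚ
  p∤⇒zℚ≢0 b p∤b e = p∤b (subst (λ c → p ∣ ℤ.∣ c ∣) (sym (zℚ≡0 {b} e)) (divides 0 refl))

  -- Any presentation with denominator prime to p shows integrality: the
  -- reduced denominator divides every denominator.
  fraction⇒integral : ∀ {x} → Fraction x → Integral x
  fraction⇒integral {mkℚ n d n⊥d} (fraction a b p∤b cleared) = integral (λ p∣d → p∤b (∣-trans p∣d d∣b))
    where
    cross : (n ℤ.* b) ℤ.* + 1 ≡ a ℤ.* + (suc d ℕ.* 1)
    cross with ℚᵘP.≃-trans (ℚᵘP.≃-sym (ℚᵘP.*-congˡ {ℚᵘ.mkℚᵘ n d} (toℚᵘ-zℚ b)))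
                 (ℚᵘP.≃-trans (ℚᵘP.≃-sym (ℚP.toℚᵘ-homo-* (mkℚ n d n⊥d) (zℚ b)))
                 (ℚᵘP.≃-trans (ℚP.toℚᵘ-cong cleared) (toℚᵘ-zℚ a)))
    ... | ℚᵘ.*≡* e = e
    cross-abs : ℤ.∣ n ∣ ℕ.* ℤ.∣ b ∣ ≡ ℤ.∣ a ∣ ℕ.* suc d
    cross-abs = begin
      ℤ.∣ n ∣ ℕ.* ℤ.∣ b ∣                ≡⟨ sym (ℤP.abs-* n b) ⟩
      ℤ.∣ n ℤ.* b ∣                       ≡⟨ cong ℤ.∣_∣ (sym (ℤP.*-identityʳ (n ℤ.* b))) ⟩
      ℤ.∣ (n ℤ.* b) ℤ.* + 1 ∣             ≡⟨ cong ℤ.∣_∣ cross ⟩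
      ℤ.∣ a ℤ.* + (suc d ℕ.* 1) ∣         ≡⟨ ℤP.abs-* a (+ (suc d ℕ.* 1)) ⟩
      ℤ.∣ a ∣ ℕ.* (suc d ℕ.* 1)           ≡⟨ cong (ℤ.∣ a ∣ ℕ.*_) (ℕP.*-identityʳ (suc d)) ⟩
      ℤ.∣ a ∣ ℕ.* suc d                   ∎
      where open ≡-Reasoning
    d∣b : suc d ∣ ℤ.∣ b ∣
    d∣b = coprime-divisor (Coprimality.sym (recompute (coprime? ℤ.∣ n ∣ (suc d)) n⊥d)) (divides ℤ.∣ a ∣ cross-abs)

  integral⇒fraction : ∀ {x} → Integral x → Fraction x
  integral⇒fraction {mkℚ n d n⊥d} (integral p∤d) = fraction n (+ suc d) p∤d
    (ℚP.toℚᵘ-injective (ℚᵘP.≃-trans (ℚP.toℚᵘ-homo-* (mkℚ n d n⊥d) (nℚ (suc d)))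
      (ℚᵘP.≃-trans (ℚᵘP.*-congˡ {ℚᵘ.mkℚᵘ n d} (toℚᵘ-zℚ (+ suc d))) (ℚᵘP.≃-trans (ℚᵘ.*≡* cross) (ℚᵘP.≃-sym (toℚᵘ-zℚ n))))))
    where
    cross : (n ℤ.* + suc d) ℤ.* + 1 ≡ n ℤ.* + (suc d ℕ.* 1)
    cross = trans (ℤP.*-identityʳ _) (cong (λ m → n ℤ.* + m) (sym (ℕP.*-identityʳ (suc d))))

  Integral-+ : ∀ {x y} → Integral x → Integral y → Integral (x + y)
  Integral-+ {x} {y} ix iy with integral⇒fraction ix | integral⇒fraction iy
  ... | fraction a b p∤b e₁ | fraction c d p∤d e₂ = fraction⇒integral (fraction (a ℤ.* d ℤ.+ c ℤ.* b) (b ℤ.* d) (p∤-*ℤ b d p∤b p∤d) (begin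
    (x + y) * zℚ (b ℤ.* d)              ≡⟨ cong (_*_ (x + y)) (zℚ-* b d) ⟩
    (x + y) * (zℚ b * zℚ d)             ≡⟨ solve 4 (λ x y B D → (x :+ y) :* (B :* D) := x :* B :* D :+ y :* D :* B) refl x y (zℚ b) (zℚ d) ⟩
    x * zℚ b * zℚ d + y * zℚ d * zℚ b   ≡⟨ cong₂ (λ u v → u * zℚ d + v * zℚ b) e₁ e₂ ⟩
    zℚ a * zℚ d + zℚ c * zℚ b           ≡⟨ sym (cong₂ _+_ (zℚ-* a d) (zℚ-* c b)) ⟩
    zℚ (a ℤ.* d) + zℚ (c ℤ.* b)         ≡⟨ sym (zℚ-+ (a ℤ.* d) (c ℤ.* b)) ⟩
    zℚ (a ℤ.* d ℤ.+ c ℤ.* b)            ∎))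
    where open ≡-Reasoning

  Integral-* : ∀ {x y} → Integral x → Integral y → Integral (x * y)
  Integral-* {x} {y} ix iy with integral⇒fraction ix | integral⇒fraction iy
  ... | fraction a b p∤b e₁ | fraction c d p∤d e₂ = fraction⇒integral (fraction (a ℤ.* c) (b ℤ.* d) (p∤-*ℤ b d p∤b p∤d) (begin
    (x * y) * zℚ (b ℤ.* d)        ≡⟨ cong (_*_ (x * y)) (zℚ-* b d) ⟩
    (x * y) * (zℚ b * zℚ d)       ≡⟨ solve 4 (λ x y B D → (x :* y) :* (B :* D) := (x :* B) :* (y :* D)) refl x y (zℚ b) (zℚ d) ⟩
    (x * zℚ b) * (y * zℚ d)       ≡⟨ cong₂ _*_ e₁ e₂ ⟩
    zℚ a * zℚ c                   ≡⟨ sym (zℚ-* a c) ⟩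
    zℚ (a ℤ.* c)                  ∎))
    where open ≡-Reasoning

  Integral-neg : ∀ {x} → Integral x → Integral (- x)
  Integral-neg {x} ix with integral⇒fraction ix
  ... | fraction a b p∤b e = fraction⇒integral (fraction (ℤ.- a) b p∤b (begin
    (- x) * zℚ b    ≡⟨ sym (ℚP.neg-distribˡ-* x (zℚ b)) ⟩
    - (x * zℚ b)    ≡⟨ cong -_ e ⟩
    - zℚ a          ≡⟨ sym (zℚ-neg a) ⟩
    zℚ (ℤ.- a)      ∎))
    where open ≡-Reasoning

  Integral-- : ∀ {x y} → Integral x → Integral y → Integral (x - y)
  Integral-- ix iy = Integral-+ ix (Integral-neg iy)

  Integral-ℤ : ∀ a → Integral (zℚ a)
  Integral-ℤ a = fraction⇒integral (fraction a (+ 1) (λ p∣1 → ℕP.<⇒≱ 1<p (∣⇒≤ p∣1)) (ℚP.*-identityʳ (zℚ a)))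

  Integral-ℕ : ∀ n → Integral (nℚ n)
  Integral-ℕ n = Integral-ℤ (+ n)

  Integral-inv-ℤ : ∀ b → ¬ p ∣ ℤ.∣ b ∣ → Integral (inv (zℚ b))
  Integral-inv-ℤ b p∤b = fraction⇒integral (fraction (+ 1) b p∤b (inv-inverseˡ (p∤⇒zℚ≢0 b p∤b)))

  Integral-inv-ℕ : ∀ n → ¬ p ∣ n → Integral (inv (nℚ n))
  Integral-inv-ℕ n = Integral-inv-ℤ (+ n)

  Integral-^ : ∀ {x} k → Integral x → Integral (x ^ℚ k)
  Integral-^ zero ix = Integral-ℕ 1
  Integral-^ (suc k) ix = Integral-* ix (Integral-^ k ix)

  pℚ : ℚ
  pℚ = nℚ p

  infix 4 _≋_
  record _≋_ (a b : ℚ) : Set where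
    constructor congruent
    field
      integralˡ : Integral a
      integralʳ : Integral b
      quotient : ℚ
      integral-quotient : Integral quotient
      difference : a - b ≡ pℚ * quotient

  toCongQ : ∀ {a b} → a ≋ b → CongQ a b p
  toCongQ (congruent ia ib c ic e) = p∤den ia , p∤den ib , c , p∤den ic , e

  ≋-refl : ∀ {a} → Integral a → a ≋ a
  ≋-refl {a} ia = congruent ia ia 0ℚ (Integral-ℕ 0) (solve 2 (λ a P → a :- a := P :* con 0ℚ) refl a pℚ)

  ≡⇒≋ : ∀ {a b} → Integral a → a ≡ b → a ≋ b
  ≡⇒≋ ia refl = ≋-refl ia

  ≋-sym : ∀ {a b} → a ≋ b → b ≋ a
  ≋-sym {a} {b} (congruent ia ib c ic e) = congruent ib ia (- c) (Integral-neg ic) (begin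
    b - a          ≡⟨ solve 2 (λ a b → b :- a := :- (a :- b)) refl a b ⟩
    - (a - b)      ≡⟨ cong -_ e ⟩
    - (pℚ * c)     ≡⟨ solve 2 (λ P c → :- (P :* c) := P :* (:- c)) refl pℚ c ⟩
    pℚ * (- c)     ∎)
    where open ≡-Reasoning

  ≋-trans : ∀ {a b c} → a ≋ b → b ≋ c → a ≋ c
  ≋-trans {a} {b} {c} (congruent ia _ u iu e) (congruent _ ic v iv e′) = congruent ia ic (u + v) (Integral-+ iu iv) (begin
    a - c              ≡⟨ solve 3 (λ a b c → a :- c := (a :- b) :+ (b :- c)) refl a b c ⟩
    (a - b) + (b - c)  ≡⟨ cong₂ _+_ e e′ ⟩
    pℚ * u + pℚ * v    ≡⟨ sym (ℚP.*-distribˡ-+ pℚ u v) ⟩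
    pℚ * (u + v)       ∎)
    where open ≡-Reasoning

  ≋-≡ˡ : ∀ {a a′ b} → a ≡ a′ → a ≋ b → a′ ≋ b
  ≋-≡ˡ refl a≋b = a≋b

  ≋-≡ʳ : ∀ {a b b′} → a ≋ b → b ≡ b′ → a ≋ b′
  ≋-≡ʳ a≋b refl = a≋b

  ≋-+ : ∀ {a b c d} → a ≋ b → c ≋ d → a + c ≋ b + d
  ≋-+ {a} {b} {c} {d} (congruent ia ib u iu e) (congruent ic id v iv e′) =
    congruent (Integral-+ ia ic) (Integral-+ ib id) (u + v) (Integral-+ iu iv) (begin
      (a + c) - (b + d)  ≡⟨ solve 4 (λ a b c d → (a :+ c) :- (b :+ d) := (a :- b) :+ (c :- d)) refl a b c d ⟩
      (a - b) + (c - d)  ≡⟨ cong₂ _+_ e e′ ⟩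
      pℚ * u + pℚ * v    ≡⟨ sym (ℚP.*-distribˡ-+ pℚ u v) ⟩
      pℚ * (u + v)       ∎)
    where open ≡-Reasoning

  ≋-* : ∀ {a b c d} → a ≋ b → c ≋ d → a * c ≋ b * d
  ≋-* {a} {b} {c} {d} (congruent ia ib u iu e) (congruent ic id v iv e′) =
    congruent (Integral-* ia ic) (Integral-* ib id) (a * v + u * d) (Integral-+ (Integral-* ia iv) (Integral-* iu id)) (begin
      a * c - b * d                ≡⟨ solve 4 (λ a b c d → a :* c :- b :* d := a :* (c :- d) :+ (a :- b) :* d) refl a b c d ⟩
      a * (c - d) + (a - b) * d    ≡⟨ cong₂ (λ s t → a * s + t * d) e′ e ⟩
      a * (pℚ * v) + (pℚ * u) * d  ≡⟨ solve 5 (λ a P v u d → a :* (P :* v) :+ (P :* u) :* d := P :* (a :* v :+ u :* d)) refl a pℚ v u d ⟩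
      pℚ * (a * v + u * d)         ∎)
    where open ≡-Reasoning

  ≋-- : ∀ {a b c d} → a ≋ b → c ≋ d → a - c ≋ b - d
  ≋-- {a} {b} {c} {d} a≋b (congruent ic id v iv e) = ≋-+ a≋b (congruent (Integral-neg ic) (Integral-neg id) (- v) (Integral-neg iv) (begin
    (- c) - (- d)  ≡⟨ solve 2 (λ c d → (:- c) :- (:- d) := :- (c :- d)) refl c d ⟩
    - (c - d)      ≡⟨ cong -_ e ⟩
    - (pℚ * v)     ≡⟨ solve 2 (λ P v → :- (P :* v) := P :* (:- v)) refl pℚ v ⟩
    pℚ * (- v)     ∎))
    where open ≡-Reasoning

  ≋-sum : ∀ n {f g : ℕ → ℚ} → (∀ k → k ℕ.≤ n → f k ≋ g k) → sumTo n f ≋ sumTo n g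
  ≋-sum zero f≋g = f≋g 0 ℕ.z≤n
  ≋-sum (suc n) f≋g = ≋-+ (≋-sum n (λ k k≤n → f≋g k (ℕP.m≤n⇒m≤1+n k≤n))) (f≋g (suc n) ℕP.≤-refl)

  Integral-inv : ∀ {x} → Integral x → ¬ (x ≋ nℚ 0) → Integral (inv x)
  Integral-inv {x} ix x≢0 with integral⇒fraction ix
  ... | fraction a b p∤b e with + p ℤSigned.∣? a
  ...   | no p∤a = fraction⇒integral (fraction b a (p∤a ∘ ℤSigned.∣ᵤ⇒∣) (solve-for-inv {x} (p∤⇒zℚ≢0 a (p∤a ∘ ℤSigned.∣ᵤ⇒∣)) e))
  ...   | yes (ℤSigned.divides c a≡cp) = ⊥-elim (x≢0 (congruent ix (Integral-ℕ 0) (zℚ c * inv (zℚ b))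
                                             (Integral-* (Integral-ℤ c) (Integral-inv-ℤ b p∤b)) (begin
    x - nℚ 0                     ≡⟨ solve 1 (λ x → x :- con 0ℚ := x) refl x ⟩
    x                            ≡⟨ solve-for {x} (p∤⇒zℚ≢0 b p∤b) e ⟩
    zℚ a * inv (zℚ b)            ≡⟨ cong (λ t → zℚ t * inv (zℚ b)) a≡cp ⟩
    zℚ (c ℤ.* + p) * inv (zℚ b)  ≡⟨ cong (_* inv (zℚ b)) (zℚ-* c (+ p)) ⟩
    zℚ c * pℚ * inv (zℚ b)       ≡⟨ solve 3 (λ c P i → c :* P :* i := P :* (c :* i)) refl (zℚ c) pℚ (inv (zℚ b)) ⟩
    pℚ * (zℚ c * inv (zℚ b))     ∎)))
    where open ≡-Reasoning

  -- C(β, j) depends on β only modulo p, as long as j < p (so j! is a unit).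
  gbinom-cong : ∀ {α β} j → α ≋ β → j ℕ.< p → gbinom α j ≋ gbinom β j
  gbinom-cong zero α≋β _ = ≋-refl (Integral-ℕ 1)
  gbinom-cong (suc j) α≋β j<p = ≋-* (≋-* (gbinom-cong j α≋β (ℕP.<-trans (ℕP.n<1+n j) j<p)) (≋-- α≋β (≋-refl (Integral-ℕ j))))
                                    (≋-refl (Integral-inv-ℕ (suc j) (p∤suc j<p)))

  module Odd (p≢2 : p ≢ 2) where

    p∤2 : ¬ p ∣ 2
    p∤2 p∣2 = p≢2 (ℕP.≤-antisym (∣⇒≤ p∣2) 1<p)

    p∤4 : ¬ p ∣ 4
    p∤4 = p∤-* {2} {2} p∤2 p∤2

    Integral-central : ∀ k → Integral (central k)
    Integral-central k = Integral-* (Integral-ℕ ((4 ℕ.* k) C (2 ℕ.* k)))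
                                    (Integral-^ k (Integral-inv-ℕ 16 (p∤-* {4} {4} p∤4 p∤4)))

    -- For p = 4q + 1 we have -1/2 ≡ 2q, hence A k ≡ C(2q, 2k) for k ≤ q.
    central≋binom : ∀ q → p ≡ 1 ℕ.+ q ℕ.* 4 → ∀ k → k ℕ.≤ q → central k ≋ binomℚ (2 ℕ.* q) (2 ℕ.* k)
    central≋binom q p≡4q+1 k k≤q =
      ≋-≡ʳ (≋-≡ˡ (sym (central≡gbinom k)) (gbinom-cong (2 ℕ.* k) negHalf≋2q 2k<p)) (sym (binom≡gbinom (2 ℕ.* q) (2 ℕ.* k)))
      where
      open ≡-Reasoning
      Integral-negHalf : Integral negHalf
      Integral-negHalf = Integral-neg (Integral-inv-ℕ 2 p∤2)
      negHalf≋2q : negHalf ≋ nℚ (2 ℕ.* q)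
      negHalf≋2q = congruent Integral-negHalf (Integral-ℕ (2 ℕ.* q)) negHalf Integral-negHalf (begin
        negHalf - nℚ (2 ℕ.* q)         ≡⟨ cong (_-_ negHalf) (nℚ-double q) ⟩
        negHalf - (nℚ q + nℚ q)        ≡⟨ solve 1 (λ Q → con negHalf :- (Q :+ Q) := (con 1ℚ :+ Q :* con (nℚ 4)) :* con negHalf) refl (nℚ q) ⟩
        (1ℚ + nℚ q * nℚ 4) * negHalf   ≡⟨ cong (_* negHalf) (sym (trans (cong nℚ p≡4q+1) (trans (nℚ-+ 1 (q ℕ.* 4)) (cong (_+_ 1ℚ) (nℚ-* q 4))))) ⟩
        pℚ * negHalf                   ∎)
      2k<p : 2 ℕ.* k ℕ.< p
      2k<p = subst (2 ℕ.* k ℕ.<_) (sym p≡4q+1) (ℕ.s≤s (ℕP.≤-trans (ℕP.*-monoʳ-≤ 2 k≤q)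
               (ℕP.≤-trans (ℕP.*-monoˡ-≤ q {2} {4} (ℕ.s≤s (ℕ.s≤s ℕ.z≤n))) (ℕP.≤-reflexive (ℕP.*-comm 4 q)))))

    -- For p = 4q + 3 we have -3/4 ≡ q, hence C(q-k, j) ≡ C(-3/4-k, j).
    binom≋gbinom : ∀ q → p ≡ 3 ℕ.+ q ℕ.* 4 → ∀ k j → k ℕ.≤ q → j ℕ.≤ q ∸ k →
      binomℚ (q ∸ k) j ≋ gbinom (negThreeQuarters - nℚ k) j
    binom≋gbinom q p≡4q+3 k j k≤q j≤q-k = ≋-≡ˡ (sym (binom≡gbinom (q ∸ k) j)) (gbinom-cong j q-k≋ j<p)
      where
      open ≡-Reasoning
      Integral-quarter : Integral quarter
      Integral-quarter = Integral-inv-ℕ 4 p∤4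
      q-k≋ : nℚ (q ∸ k) ≋ negThreeQuarters - nℚ k
      q-k≋ = congruent (Integral-ℕ (q ∸ k)) (Integral-- (Integral-neg (Integral-* (Integral-ℕ 3) Integral-quarter)) (Integral-ℕ k))
                       quarter Integral-quarter (begin
        nℚ (q ∸ k) - (negThreeQuarters - nℚ k)      ≡⟨ cong (_- (negThreeQuarters - nℚ k)) (nℚ-∸ k≤q) ⟩
        (nℚ q - nℚ k) - (negThreeQuarters - nℚ k)   ≡⟨ solve 2 (λ Q K → (Q :- K) :- (con negThreeQuarters :- K) := (con (nℚ 3) :+ Q :* con (nℚ 4)) :* con quarter) refl (nℚ q) (nℚ k) ⟩
        (nℚ 3 + nℚ q * nℚ 4) * quarter              ≡⟨ cong (_* quarter) (sym (trans (cong nℚ p≡4q+3) (trans (nℚ-+ 3 (q ℕ.* 4)) (cong (_+_ (nℚ 3)) (nℚ-* q 4))))) ⟩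
        pℚ * quarter                                ∎)
      j<p : j ℕ.< p
      j<p = subst (j ℕ.<_) (sym p≡4q+3) (ℕ.s≤s (ℕP.≤-trans j≤q-k (ℕP.≤-trans (ℕP.m∸n≤m q k)
              (ℕP.≤-trans (ℕP.m≤m*n q 4) (ℕP.m≤n+m (q ℕ.* 4) 2)))))

    part-i : ∀ q → p ≡ 1 ℕ.+ q ℕ.* 4 → ∀ {x y} → Integral x → Integral y → x * y ≡ 1ℚ →
      centralSum q x ≋ (x ^ℚ q) * centralSum q y
    part-i q p≡4q+1 {x} {y} ix iy xy≡1 =
      ≋-trans (≋-sum q (λ k k≤q → ≋-* (central≋binom q p≡4q+1 k k≤q) (≋-refl (Integral-^ k ix))))
              (≋-sym (≋-≡ʳ (≋-* (≋-refl (Integral-^ q ix)) (≋-sum q (λ k k≤q → ≋-* (central≋binom q p≡4q+1 k k≤q) (≋-refl (Integral-^ k iy)))))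
                           (even-binomial-palindrome q xy≡1)))

    part-ii : ∀ q → p ≡ 3 ℕ.+ q ℕ.* 4 → ∀ {x y} → Integral y → x * y ≡ 1ℚ → 1ℚ - y ≢ 0ℚ →
      centralSum q y ≋ ((1ℚ - y) ^ℚ q) * centralSum q (inv (1ℚ - x))
    part-ii q p≡4q+3 {x} {y} iy xy≡1 1-y≢0 =
      ≋-sym (≋-≡ˡ (sym (expand-shifted-series q {x} xy≡1 1-y≢0)) (≋-≡ʳ (≋-sum q expand-binomial) (collect-convolution q y)))
      where
      z : ℚ
      z = - y
      expand-binomial : ∀ k → k ℕ.≤ q →
        central k * ((z ^ℚ k) * ((1ℚ - y) ^ℚ (q ∸ k)))
          ≋ central k * ((z ^ℚ k) * sumTo (q ∸ k) (λ j → gbinom (negThreeQuarters - nℚ k) j * (z ^ℚ j)))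
      expand-binomial k k≤q =
        ≋-≡ˡ (cong (λ t → central k * ((z ^ℚ k) * t)) (sym (binomial-theorem (q ∸ k) z)))
             (≋-* (≋-refl (Integral-central k)) (≋-* (≋-refl (Integral-^ k (Integral-neg iy)))
               (≋-sum (q ∸ k) (λ j j≤q-k → ≋-* (binom≋gbinom q p≡4q+3 k j k≤q j≤q-k) (≋-refl (Integral-^ j (Integral-neg iy)))))))

-- With q = ⌊p/4⌋ and y = 1/x (a unit of ℤ₍ₚ₎ since x ≢ 0, and y ≠ 1 since
-- x ≢ 1), both parts are `part-i`/`part-ii` once the series are read as S_q.
theorem2p2 : (p : ℕ) → Prime p → p ≢ 2 → (x : ℚ) → PIntegral p x →
    ¬ CongQ x (nℚ 0) p → ¬ CongQ x 1ℚ p →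
    (p % 4 ≡ 1 →
      CongQ (sumTo (p / 4) (λ k → binomℚ (4 ℕ.* k) (2 ℕ.* k) * ((x * inv (nℚ 16)) ^ℚ k)))
            ((x ^ℚ ((p ∸ 1) / 4)) * sumTo (p / 4) (λ k → binomℚ (4 ℕ.* k) (2 ℕ.* k) * inv ((nℚ 16 * x) ^ℚ k)))
            p)
    × (p % 4 ≡ 3 →
      CongQ (sumTo (p / 4) (λ k → binomℚ (4 ℕ.* k) (2 ℕ.* k) * inv ((nℚ 16 * x) ^ℚ k)))
            (((1ℚ - inv x) ^ℚ ((p ∸ 3) / 4)) * sumTo (p / 4) (λ k → binomℚ (4 ℕ.* k) (2 ℕ.* k) * inv ((nℚ 16 * (1ℚ - x)) ^ℚ k)))
            p)
theorem2p2 p p-prime p≢2 x x-integral x≢0 x≢1 =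
    (λ p%4≡1 → toCongQ (≋-≡ˡ (sym (series-scaled q x))
      (≋-≡ʳ (part-i q (division-identity p 4 p%4≡1) ix iy xy≡1)
            (cong₂ (λ e s → (x ^ℚ e) * s) (sym (quotient-after-remainder p 4 p%4≡1)) (sym (series-inverse q x))))))
  , (λ p%4≡3 → toCongQ (≋-≡ˡ (sym (series-inverse q x))
      (≋-≡ʳ (part-ii q (division-identity p 4 p%4≡3) {x} iy xy≡1 1-y≢0)
            (cong₂ (λ e s → ((1ℚ - inv x) ^ℚ e) * s) (sym (quotient-after-remainder p 4 p%4≡3)) (sym (series-inverse q (1ℚ - x)))))))
  where
  open Modulo p p-prime
  open Odd p≢2
  q : ℕ
  q = p / 4
  ix : Integral x
  ix = integral x-integral
  xy≡1 : x * inv x ≡ 1ℚ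
  xy≡1 = inv-inverseʳ (λ x≡0 → x≢0 (toCongQ (≡⇒≋ ix x≡0)))
  iy : Integral (inv x)
  iy = Integral-inv ix (x≢0 ∘ toCongQ)
  1-y≢0 : 1ℚ - inv x ≢ 0ℚ
  1-y≢0 1-y≡0 = x≢1 (toCongQ (≡⇒≋ ix (inverse-of-one xy≡1 1-y≡0)))
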